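{- For every integer $r\geq 2$ there is a constant $C=C(r)$ (depending only on $r$) such that for all $0<p<1$, $\delta>0$, and all $n$ sufficiently large, the following holds. If $G$ is an $n$-vertex graph satisfying $\mathcal{P}^*_{K_r,p}(\delta)$, then for every $U\subseteq V(G)$, $$\sum_{u\in U}\mathrm{disc}_U(u)\le C\delta n^r.$$
   Context: A labeled $r$-clique is an ordered $r$-tuple of distinct pairwise adjacent vertices. $G$ satisfies $\mathcal{P}^*_{K_r,p}(\delta)$ if for every $S\subseteq V(G)$ the number of labeled $r$-cliques with all vertices in $S$ is within $\delta n^r$ of $p^{\binom r2}|S|^r$. For $U\subseteq V(G)$ and $u\in U$, $c_U(u)$ denotes the number of $r$-cliques (vertex sets of size $r$ inducing a complete graph) contained in $U$ and containing $u$, and $\mathrm{disc}_U(u)=\big|c_U(u)-p^{\binom r2}|U|^{r-1}/(r-1)!\big|$.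
   Formalization: The parameters p and δ range over the rationals. -}

module Defs where

open import Data.Bool using (Bool; true; false; _∧_; _∨_; not; if_then_else_)
open import Data.Nat as ℕ using (ℕ; zero; suc; _∸_; _!; _<ᵇ_)
open import Data.Nat.Combinatorics using (_C_)
open import Data.Nat.Properties using (_!≢0)
open import Data.Fin using (Fin; toℕ; _≟_)
open import Data.Fin.Subset using (Subset; _∈_; ∣_∣)
open import Data.Fin.Subset.Properties using (_∈?_)
open import Data.Vec as Vec using (Vec; []; _∷_)
open import Data.List as List using (List; []; _∷_; concatMap; allFin)
open import Data.Integer using (+_)
open import Data.Rational as ℚ using (ℚ; _*_; _-_; _/_)
open import Relation.Nullary using (does)
open import Relation.Binary.PropositionalEquality using (_≡_)

record Graph (n : ℕ) : Set where
  field
    adj    : Fin n → Fin n → Bool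
    sym    : ∀ x y → adj x y ≡ adj y x
    irrefl : ∀ x → adj x x ≡ false
open Graph public

tuples : {n : ℕ} (r : ℕ) → List (Vec (Fin n) r)
tuples zero    = [] ∷ []
tuples {n} (suc r) = concatMap (λ x → List.map (x ∷_) (tuples r)) (allFin n)

count : {A : Set} → (A → Bool) → List A → ℕ
count P []       = 0
count P (x ∷ xs) = (if P x then 1 else 0) ℕ.+ count P xs

allV : {A : Set} {k : ℕ} → (A → Bool) → Vec A k → Bool
allV P []       = true
allV P (x ∷ xs) = P x ∧ allV P xs

anyV : {A : Set} {k : ℕ} → (A → Bool) → Vec A k → Bool
anyV P []       = false
anyV P (x ∷ xs) = P x ∨ anyV P xs

pairwise : {A : Set} {k : ℕ} → (A → A → Bool) → Vec A k → Bool
pairwise R []       = true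
pairwise R (x ∷ xs) = allV (R x) xs ∧ pairwise R xs

module _ {n : ℕ} (G : Graph n) where

  inside : {k : ℕ} → Subset n → Vec (Fin n) k → Bool
  inside S = allV (λ x → does (x ∈? S))

  -- labeled r-clique: ordered r-tuple of distinct pairwise adjacent vertices
  -- (G is symmetric, so checking pairs i < j suffices)
  isLabeledClique : {r : ℕ} → Vec (Fin n) r → Bool
  isLabeledClique = pairwise (λ x y → not (does (x ≟ y)) ∧ adj G x y)

  labeledCliques : (r : ℕ) → Subset n → ℕ
  labeledCliques r S = count (λ v → inside S v ∧ isLabeledClique v) (tuples r)

  -- An r-element vertex set is
  -- represented uniquely by its strictly increasing enumeration.
  cU : (r : ℕ) → Subset n → Fin n → ℕ
  cU r U u = count (λ v → pairwise (λ x y → toℕ x <ᵇ toℕ y) v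
                          ∧ pairwise (adj G) v
                          ∧ inside U v
                          ∧ anyV (λ x → does (x ≟ u)) v)
                   (tuples r)

_^ℚ_ : ℚ → ℕ → ℚ
x ^ℚ zero  = ℚ.1ℚ
x ^ℚ suc k = x * (x ^ℚ k)

invFact : ℕ → ℚ
invFact k = (+ 1) / (k !) where instance _ = k !≢0

ℕ→ℚ : ℕ → ℚ
ℕ→ℚ k = (+ k) / 1

PStar : {n : ℕ} → Graph n → (r : ℕ) → (p δ : ℚ) → Set
PStar {n} G r p δ =
  (S : Subset n) →
  ℚ.∣ ℕ→ℚ (labeledCliques G r S) - (p ^ℚ (r C 2)) * ℕ→ℚ (∣ S ∣ ℕ.^ r) ∣
    ℚ.≤ δ * ℕ→ℚ (n ℕ.^ r)

disc : {n : ℕ} → Graph n → (r : ℕ) → (p : ℚ) → Subset n → Fin n → ℚ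
disc G r p U u =
  ℚ.∣ ℕ→ℚ (cU G r U u) - (p ^ℚ (r C 2)) * ℕ→ℚ (∣ U ∣ ℕ.^ (r ∸ 1)) * invFact (r ∸ 1) ∣

sumOver : {n : ℕ} → Subset n → (Fin n → ℚ) → ℚ
sumOver {n} U f = List.foldr (λ u acc → (if does (u ∈? U) then f u else ℚ.0ℚ) ℚ.+ acc)
                             ℚ.0ℚ (allFin n)

-- Write r = k + 1 and q = p^(r choose 2).  Fix U and W ⊆ U, and let S ⊆ U be random, containing
-- each vertex of W independently with probability t and every other vertex of U.  The expected
-- value of L(S) - q |S|^r, where L counts labeled r-cliques, is a polynomial P_W(t) of degree ≤ r,
-- and P* bounds it by δ n^r on [0, 1].  Dividing out linear factors at the r + 1 points j / r
-- (Newton's scheme) bounds P_W′(1) by a constant times δ n^r.  Differentiating term by term,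
-- P_W′(1) = Σ_{u ∈ W} (r! c_U(u) - q (|U|^r - (|U| - 1)^r)), which is within (r-1)² |U|^(r-1) ≤ δ n^r
-- (for n large) of r! Σ_{u ∈ W} (c_U(u) - q |U|^(r-1) / (r-1)!).  Taking for W the vertices u of U
-- with c_U(u) ≥ q |U|^(r-1) / (r-1)!, resp. the other ones, and subtracting the two estimates
-- gives r! Σ_{u ∈ U} disc_U(u) = O(δ n^r).

module Submission where

open import Algebra.Bundles using (CommutativeSemiring)

module ListSum {c ℓ} (R : CommutativeSemiring c ℓ) where
  open import Data.Bool using (Bool; true; false; if_then_else_)
  open import Data.List using (List; []; _∷_; _++_; concatMap)
  open CommutativeSemiring R renaming (refl to ≈-refl; sym to ≈-sym; trans to ≈-trans)
  open import Relation.Binary.Reasoning.Setoid setoid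
  open import Algebra.Properties.CommutativeSemigroup +-commutativeSemigroup using (interchange)

  ∑ : {A : Set} → (A → Carrier) → List A → Carrier
  ∑ f []       = 0#
  ∑ f (x ∷ xs) = f x + ∑ f xs

  module _ {A : Set} where
    ∑-cong : ∀ {f g : A → Carrier} xs → (∀ x → f x ≈ g x) → ∑ f xs ≈ ∑ g xs
    ∑-cong []       f≈g = ≈-refl
    ∑-cong (x ∷ xs) f≈g = +-cong (f≈g x) (∑-cong xs f≈g)

    ∑-zero : ∀ xs → ∑ (λ (_ : A) → 0#) xs ≈ 0#
    ∑-zero []       = ≈-refl
    ∑-zero (x ∷ xs) = ≈-trans (+-congˡ (∑-zero xs)) (+-identityˡ 0#)

    ∑-+ : ∀ (f g : A → Carrier) xs → ∑ (λ x → f x + g x) xs ≈ ∑ f xs + ∑ g xs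
    ∑-+ f g []       = ≈-sym (+-identityˡ 0#)
    ∑-+ f g (x ∷ xs) = ≈-trans (+-congˡ (∑-+ f g xs)) (interchange (f x) (g x) (∑ f xs) (∑ g xs))

    ∑-*ˡ : ∀ a (f : A → Carrier) xs → ∑ (λ x → a * f x) xs ≈ a * ∑ f xs
    ∑-*ˡ a f []       = ≈-sym (zeroʳ a)
    ∑-*ˡ a f (x ∷ xs) = ≈-trans (+-congˡ (∑-*ˡ a f xs)) (≈-sym (distribˡ a (f x) (∑ f xs)))

    ∑-*ʳ : ∀ a (f : A → Carrier) xs → ∑ (λ x → f x * a) xs ≈ ∑ f xs * a
    ∑-*ʳ a f xs = begin
      ∑ (λ x → f x * a) xs ≈⟨ ∑-cong xs (λ x → *-comm (f x) a) ⟩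
      ∑ (λ x → a * f x) xs ≈⟨ ∑-*ˡ a f xs ⟩
      a * ∑ f xs           ≈⟨ *-comm a (∑ f xs) ⟩
      ∑ f xs * a           ∎

    ∑-if : ∀ b (f : A → Carrier) xs → (if b then ∑ f xs else 0#) ≈ ∑ (λ x → if b then f x else 0#) xs
    ∑-if true  f xs = ≈-refl
    ∑-if false f xs = ≈-sym (∑-zero xs)

    ∑-++ : ∀ (f : A → Carrier) xs ys → ∑ f (xs ++ ys) ≈ ∑ f xs + ∑ f ys
    ∑-++ f []       ys = ≈-sym (+-identityˡ (∑ f ys))
    ∑-++ f (x ∷ xs) ys = ≈-trans (+-congˡ (∑-++ f xs ys)) (≈-sym (+-assoc (f x) (∑ f xs) (∑ f ys)))

  module _ {A B : Set} where
    ∑-concatMap : ∀ (f : B → Carrier) (g : A → List B) xs →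
                  ∑ f (concatMap g xs) ≈ ∑ (λ x → ∑ f (g x)) xs
    ∑-concatMap f g []       = ≈-refl
    ∑-concatMap f g (x ∷ xs) = ≈-trans (∑-++ f (g x) (concatMap g xs)) (+-congˡ (∑-concatMap f g xs))

    ∑-swap : ∀ (f : A → B → Carrier) xs ys →
             ∑ (λ x → ∑ (f x) ys) xs ≈ ∑ (λ y → ∑ (λ x → f x y) xs) ys
    ∑-swap f []       ys = ≈-sym (∑-zero ys)
    ∑-swap f (x ∷ xs) ys = begin
      ∑ (f x) ys + ∑ (λ x → ∑ (f x) ys) xs           ≈⟨ +-congˡ (∑-swap f xs ys) ⟩
      ∑ (f x) ys + ∑ (λ y → ∑ (λ x → f x y) xs) ys  ≈⟨ ∑-+ (f x) (λ y → ∑ (λ x → f x y) xs) ys ⟨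
      ∑ (λ y → ∑ (λ x → f x y) (x ∷ xs)) ys          ∎

module PowerBounds where
  open import Data.Nat using (ℕ; zero; suc; _+_; _*_; _^_; _∸_; _≤_)
  open import Data.Nat.Properties
  open import Data.Nat.Tactic.RingSolver using (solve-∀)
  open import Relation.Binary.PropositionalEquality using (_≡_; cong)
  open ≤-Reasoning

  [1+a]^[1+k]≤a^[1+k]+[1+k][1+a]^k : ∀ a k → suc a ^ suc k ≤ a ^ suc k + suc k * suc a ^ k
  [1+a]^[1+k]≤a^[1+k]+[1+k][1+a]^k a zero = ≤-reflexive (base a)
    where
    base : ∀ a → suc a * 1 ≡ a * 1 + 1 * 1
    base = solve-∀
  [1+a]^[1+k]≤a^[1+k]+[1+k][1+a]^k a (suc k) = begin
    s * s ^ suc k                                      ≤⟨ *-monoʳ-≤ s ([1+a]^[1+k]≤a^[1+k]+[1+k][1+a]^k a k) ⟩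
    s * (A + suc k * S)                                ≡⟨ expand a A k S ⟩
    a * A + (A + suc k * (s * S))                      ≤⟨ +-monoʳ-≤ (a * A) (+-monoˡ-≤ _ A≤s^[1+k]) ⟩
    a * A + (s ^ suc k + suc k * (s * S))              ≡⟨ collect a (a * A) k S ⟩
    a * A + suc (suc k) * (s * S)                      ∎
    where
    s A S : ℕ
    s = suc a
    A = a ^ suc k
    S = s ^ k
    A≤s^[1+k] : A ≤ s ^ suc k
    A≤s^[1+k] = ^-monoˡ-≤ (suc k) (n≤1+n a)
    expand : ∀ a A k S → suc a * (A + suc k * S) ≡ a * A + (A + suc k * (suc a * S))
    expand = solve-∀
    collect : ∀ a X k S → X + (suc a * S + suc k * (suc a * S)) ≡ X + suc (suc k) * (suc a * S)
    collect = solve-∀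

  [1+a][a^[1+k]+[1+k][1+a]^k]≤[1+a]^[2+k]+k²[1+a]^k :
    ∀ a k → suc a * (a ^ suc k + suc k * suc a ^ k) ≤ suc a * suc a ^ suc k + k * k * suc a ^ k
  [1+a][a^[1+k]+[1+k][1+a]^k]≤[1+a]^[2+k]+k²[1+a]^k a zero = ≤-reflexive (base a)
    where
    base : ∀ a → suc a * (a * 1 + 1 * 1) ≡ suc a * (suc a * 1) + 0 * 0 * 1
    base = solve-∀
  [1+a][a^[1+k]+[1+k][1+a]^k]≤[1+a]^[2+k]+k²[1+a]^k a (suc k) = begin
    s * (a * A + suc (suc k) * (s * S))                 ≡⟨ expand a A k S ⟩
    s * a * A + suc k * s * s * S + s * (s * S)         ≤⟨ +-monoʳ-≤ (s * a * A + suc k * s * s * S)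
                                                             (*-monoʳ-≤ s ([1+a]^[1+k]≤a^[1+k]+[1+k][1+a]^k a k)) ⟩
    s * a * A + suc k * s * s * S + s * (A + suc k * S) ≡⟨ regroup a A k S ⟩
    s * (s * (A + suc k * S)) + suc k * (s * S)         ≤⟨ +-monoˡ-≤ (suc k * (s * S))
                                                             (*-monoʳ-≤ s ([1+a][a^[1+k]+[1+k][1+a]^k]≤[1+a]^[2+k]+k²[1+a]^k a k)) ⟩
    s * (s * (s * S) + k * k * S) + suc k * (s * S)     ≡⟨ collect a k S ⟩
    s * (s * (s * S)) + (k * k + suc k) * (s * S)       ≤⟨ +-monoʳ-≤ (s * (s * (s * S))) (*-monoˡ-≤ (s * S) k²+k+1≤[k+1]²) ⟩
    s * (s * (s * S)) + suc k * suc k * (s * S)         ∎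
    where
    s A S : ℕ
    s = suc a
    A = a ^ suc k
    S = s ^ k
    k²+k+1≤[k+1]² : k * k + suc k ≤ suc k * suc k
    k²+k+1≤[k+1]² = ≤-trans (m≤m+n (k * k + suc k) k) (≤-reflexive (square k))
      where
      square : ∀ k → k * k + suc k + k ≡ suc k * suc k
      square = solve-∀
    expand : ∀ a A k S → suc a * (a * A + suc (suc k) * (suc a * S))
                         ≡ suc a * a * A + suc k * suc a * suc a * S + suc a * (suc a * S)
    expand = solve-∀
    regroup : ∀ a A k S → suc a * a * A + suc k * suc a * suc a * S + suc a * (A + suc k * S)
                          ≡ suc a * (suc a * (A + suc k * S)) + suc k * (suc a * S)
    regroup = solve-∀
    collect : ∀ a k S → suc a * (suc a * (suc a * S) + k * k * S) + suc k * (suc a * S)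
                        ≡ suc a * (suc a * (suc a * S)) + (k * k + suc k) * (suc a * S)
    collect = solve-∀

  powerGap : ℕ → ℕ → ℕ
  powerGap a k = suc a ^ suc k ∸ a ^ suc k

  powerGap≤[1+k][1+a]^k : ∀ a k → powerGap a k ≤ suc k * suc a ^ k
  powerGap≤[1+k][1+a]^k a k = m≤n+o⇒m∸n≤o (suc a ^ suc k) (a ^ suc k) ([1+a]^[1+k]≤a^[1+k]+[1+k][1+a]^k a k)

  [1+a][[1+k][1+a]^k∸powerGap]≤k²[1+a]^k : ∀ a k → suc a * (suc k * suc a ^ k ∸ powerGap a k) ≤ k * k * suc a ^ k
  [1+a][[1+k][1+a]^k∸powerGap]≤k²[1+a]^k a k = begin
    s * (X ∸ powerGap a k)      ≡⟨ *-distribˡ-∸ s X (powerGap a k) ⟩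
    s * X ∸ s * powerGap a k   ≤⟨ m≤n+o⇒m∸n≤o (s * X) (s * powerGap a k) (+-cancelˡ-≤ (s * A) _ _ (begin
      s * A + s * X                              ≡⟨ *-distribˡ-+ s A X ⟨
      s * (A + X)                                ≤⟨ [1+a][a^[1+k]+[1+k][1+a]^k]≤[1+a]^[2+k]+k²[1+a]^k a k ⟩
      s * s ^ suc k + k * k * s ^ k              ≡⟨ cong (λ m → s * m + k * k * s ^ k) (m∸n+n≡m A≤s^[1+k]) ⟨
      s * (powerGap a k + A) + k * k * s ^ k     ≡⟨ regroup s (powerGap a k) A (k * k * s ^ k) ⟩
      s * A + (s * powerGap a k + k * k * s ^ k) ∎)) ⟩
    k * k * s ^ k               ∎
    where
    s A X : ℕ
    s = suc a
    A = a ^ suc k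
    X = suc k * s ^ k
    A≤s^[1+k] : A ≤ s ^ suc k
    A≤s^[1+k] = ^-monoˡ-≤ (suc k) (n≤1+n a)
    regroup : ∀ s M A Y → s * (M + A) + Y ≡ s * A + (s * M + Y)
    regroup = solve-∀

open import Defs hiding (sym)
open import Algebra.Bundles using (CommutativeRing)
open import Data.Bool using (Bool; true; false; if_then_else_; _∧_; _∨_; not)
import Data.Bool.Properties as Bool
open import Data.Fin using (Fin; zero; suc; toℕ; _≟_)
open import Data.Fin.Subset using (Subset; _∈_; _∪_; ⁅_⁆; ⊥) renaming (∣_∣ to ∣_∣ˢ)
open import Data.Fin.Subset.Properties using (_∈?_; ∉⊥; ∣p∣≤n; x∈⁅x⁆; x∈⁅y⁆⇒x≡y; x∈p∪q⁻; x∈p∪q⁺)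
open import Data.Vec using (Vec; []; _∷_)
open import Data.List.Membership.Propositional.Properties using (∈-allFin)
open import Data.List.Relation.Unary.Unique.Propositional using (Unique)
open import Data.List.Relation.Unary.Unique.Propositional.Properties using (allFin⁺)
open import Function using (mk⇔; Equivalence)
open import Relation.Binary using (tri<; tri≈; tri>)
import Data.Fin.Properties as Fin
open import Relation.Nullary using (Dec; does; yes; no; contradiction)
open import Relation.Nullary.Decidable using (dec-true; dec-false; does-⇔; _⊎-dec_)
open import Data.Integer as ℤ using (+[1+_]; -[1+_])
import Data.Integer.Properties as ℤ
open import Data.List using (List; []; _∷_; _++_; map; concatMap; allFin; length; applyUpTo; foldr)
open import Data.List.Properties using (length-applyUpTo; map-tabulate)
open import Data.List.Relation.Unary.All as All using (All; []; _∷_)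
import Data.List.Relation.Unary.All.Properties as All
open import Data.List.Relation.Unary.AllPairs as AllPairs using (AllPairs; []; _∷_)
import Data.List.Relation.Unary.AllPairs.Properties as AllPairs
open import Data.Nat as ℕ using (ℕ; zero; suc; _!; z≤n; s≤s; _<ᵇ_; _≥_)
open import Data.Nat.Combinatorics using (_C_)
import Data.Nat.Properties as ℕ
open import Data.Sum using (_⊎_; inj₁; inj₂; map₂)
open import Data.Product using (Σ; _×_; _,_; proj₂)
open import Data.Rational as ℚ using (ℚ; _+_; _*_; _-_; -_; 0ℚ; 1ℚ; _≤_; _<_; ∣_∣; ↧ₙ_)
open import Data.Rational.Properties hiding (_≟_)
import Data.Rational.Unnormalised as ℚᵘ
import Data.Rational.Unnormalised.Properties as ℚᵘ
open import Data.Rational.Literals using (fromℤ)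
open import Relation.Binary.PropositionalEquality
  using (_≡_; refl; sym; trans; cong; cong₂; subst; subst₂; module ≡-Reasoning)
open import Tactic.RingSolver using (solve-∀)
open import Tactic.RingSolver.Core.AlmostCommutativeRing using (AlmostCommutativeRing; fromCommutativeRing)
open import Level using (0ℓ)
open import Relation.Nullary.Decidable.Core using (dec⇒maybe)

ℚ-ring : AlmostCommutativeRing 0ℓ 0ℓ
ℚ-ring = fromCommutativeRing +-*-commutativeRing (λ x → dec⇒maybe (0ℚ ℚ.≟ x))

ℕ→ℚ≡fromℤ : ∀ k → ℕ→ℚ k ≡ fromℤ (ℤ.+ k)
ℕ→ℚ≡fromℤ k = ↥p/↧p≡p (fromℤ (ℤ.+ k))

ℕ→ℚ-+ : ∀ a b → ℕ→ℚ (a ℕ.+ b) ≡ ℕ→ℚ a + ℕ→ℚ b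
ℕ→ℚ-+ a b rewrite ℕ→ℚ≡fromℤ (a ℕ.+ b) | ℕ→ℚ≡fromℤ a | ℕ→ℚ≡fromℤ b =
  toℚᵘ-injective (ℚᵘ.≃-trans (ℚᵘ.*≡* numerators) (ℚᵘ.≃-sym (toℚᵘ-homo-+ (fromℤ (ℤ.+ a)) (fromℤ (ℤ.+ b)))))
  where
  numerators : ℤ.+ (a ℕ.+ b) ℤ.* ℤ.+ 1 ≡ (ℤ.+ a ℤ.* ℤ.+ 1 ℤ.+ ℤ.+ b ℤ.* ℤ.+ 1) ℤ.* ℤ.+ 1
  numerators rewrite ℤ.*-identityʳ (ℤ.+ a) | ℤ.*-identityʳ (ℤ.+ b) | ℤ.*-identityʳ (ℤ.+ a ℤ.+ ℤ.+ b) = ℤ.pos-+ a b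

ℕ→ℚ-* : ∀ a b → ℕ→ℚ (a ℕ.* b) ≡ ℕ→ℚ a * ℕ→ℚ b
ℕ→ℚ-* a b rewrite ℕ→ℚ≡fromℤ (a ℕ.* b) | ℕ→ℚ≡fromℤ a | ℕ→ℚ≡fromℤ b =
  toℚᵘ-injective (ℚᵘ.≃-trans (ℚᵘ.*≡* numerators) (ℚᵘ.≃-sym (toℚᵘ-homo-* (fromℤ (ℤ.+ a)) (fromℤ (ℤ.+ b)))))
  where
  numerators : ℤ.+ (a ℕ.* b) ℤ.* ℤ.+ 1 ≡ (ℤ.+ a ℤ.* ℤ.+ b) ℤ.* ℤ.+ 1
  numerators rewrite ℤ.*-identityʳ (ℤ.+ a ℤ.* ℤ.+ b) = trans (ℤ.*-identityʳ (ℤ.+ (a ℕ.* b))) (ℤ.pos-* a b)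

ℕ→ℚ-mono-≤ : ∀ {a b} → a ℕ.≤ b → ℕ→ℚ a ≤ ℕ→ℚ b
ℕ→ℚ-mono-≤ {a} {b} a≤b rewrite ℕ→ℚ≡fromℤ a | ℕ→ℚ≡fromℤ b =
  ℚ.*≤* (subst₂ ℤ._≤_ (sym (ℤ.*-identityʳ (ℤ.+ a))) (sym (ℤ.*-identityʳ (ℤ.+ b))) (ℤ.+≤+ a≤b))

0≤ℕ→ℚ : ∀ k → 0ℚ ≤ ℕ→ℚ k
0≤ℕ→ℚ k = ℕ→ℚ-mono-≤ {0} {k} z≤n

ℕ→ℚ-*-inverse : ∀ m .{{_ : ℕ.NonZero m}} → ℕ→ℚ m * (ℤ.+ 1 ℚ./ m) ≡ 1ℚ
ℕ→ℚ-*-inverse (suc m) =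
  trans (cong₂ _*_ (ℕ→ℚ≡fromℤ (suc m)) (↥p/↧p≡p (ℚ.mkℚ (ℤ.+ 1) m (1-coprimeTo (suc m)))))
        (*-inverseʳ (fromℤ (ℤ.+ suc m)))
  where open import Data.Nat.Coprimality using (1-coprimeTo)

1≤p*↧p : ∀ p → 0ℚ < p → 1ℚ ≤ p * ℕ→ℚ (↧ₙ p)
1≤p*↧p p@(ℚ.mkℚ +[1+ m ] d _) _ rewrite ℕ→ℚ≡fromℤ (suc d) =
  toℚᵘ-cancel-≤ (ℚᵘ.≤-respʳ-≃ (ℚᵘ.≃-sym (toℚᵘ-homo-* p (fromℤ (ℤ.+ suc d)))) (ℚᵘ.*≤* cross))
  where
  cross : ℤ.+ 1 ℤ.* ℤ.+ (suc d ℕ.* 1) ℤ.≤ (+[1+ m ] ℤ.* +[1+ d ]) ℤ.* ℤ.+ 1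
  cross = subst₂ ℤ._≤_
    (sym (trans (ℤ.*-identityˡ _) (cong ℤ.+_ (ℕ.*-identityʳ (suc d)))))
    (sym (trans (ℤ.*-identityʳ _) (sym (ℤ.pos-* (suc m) (suc d)))))
    (ℤ.+≤+ (ℕ.m≤n*m (suc d) (suc m)))
1≤p*↧p (ℚ.mkℚ (ℤ.+ 0) d _) (ℚ.*<* (ℤ.+<+ ()))
1≤p*↧p (ℚ.mkℚ -[1+ m ] d _) (ℚ.*<* ())

ℕ→ℚ[m]≤p*ℕ→ℚ[n] : ∀ p m n → 0ℚ < p → m ℕ.* ↧ₙ p ℕ.≤ n → ℕ→ℚ m ≤ p * ℕ→ℚ n
ℕ→ℚ[m]≤p*ℕ→ℚ[n] p m n 0<p m↧p≤n = begin
  ℕ→ℚ m                        ≡⟨ *-identityʳ (ℕ→ℚ m) ⟨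
  ℕ→ℚ m * 1ℚ                   ≤⟨ *-monoˡ-≤-nonNeg (ℕ→ℚ m) {{ℚ.nonNegative (0≤ℕ→ℚ m)}} (1≤p*↧p p 0<p) ⟩
  ℕ→ℚ m * (p * ℕ→ℚ (↧ₙ p))     ≡⟨ x*[y*z]≡y*[x*z] (ℕ→ℚ m) p (ℕ→ℚ (↧ₙ p)) ⟩
  p * (ℕ→ℚ m * ℕ→ℚ (↧ₙ p))     ≡⟨ cong (p *_) (ℕ→ℚ-* m (↧ₙ p)) ⟨
  p * ℕ→ℚ (m ℕ.* ↧ₙ p)         ≤⟨ *-monoˡ-≤-nonNeg p {{ℚ.nonNegative (<⇒≤ 0<p)}} (ℕ→ℚ-mono-≤ m↧p≤n) ⟩
  p * ℕ→ℚ n                    ∎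
  where
  open ≤-Reasoning
  x*[y*z]≡y*[x*z] : ∀ x y z → x * (y * z) ≡ y * (x * z)
  x*[y*z]≡y*[x*z] = solve-∀ ℚ-ring

*-monoˡ-≤-0≤ : ∀ {p q} r → 0ℚ ≤ r → p ≤ q → r * p ≤ r * q
*-monoˡ-≤-0≤ r 0≤r = *-monoˡ-≤-nonNeg r {{ℚ.nonNegative 0≤r}}

*-monoʳ-≤-0≤ : ∀ {p q} r → 0ℚ ≤ r → p ≤ q → p * r ≤ q * r
*-monoʳ-≤-0≤ r 0≤r = *-monoʳ-≤-nonNeg r {{ℚ.nonNegative 0≤r}}

*-mono-≤-0≤ : ∀ {a b c d} → 0ℚ ≤ a → a ≤ b → 0ℚ ≤ c → c ≤ d → a * c ≤ b * d
*-mono-≤-0≤ {b = b} {c = c} 0≤a a≤b 0≤c c≤d =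
  ≤-trans (*-monoʳ-≤-0≤ c 0≤c a≤b) (*-monoˡ-≤-0≤ b (≤-trans 0≤a a≤b) c≤d)

0≤* : ∀ {a b} → 0ℚ ≤ a → 0ℚ ≤ b → 0ℚ ≤ a * b
0≤* {a} {b} 0≤a 0≤b = subst (_≤ a * b) (*-zeroˡ b) (*-monoʳ-≤-0≤ b 0≤b 0≤a)

0≤+ : ∀ {a b} → 0ℚ ≤ a → 0ℚ ≤ b → 0ℚ ≤ a + b
0≤+ {a} {b} 0≤a 0≤b = subst (_≤ a + b) (+-identityˡ 0ℚ) (+-mono-≤ 0≤a 0≤b)

p≤q⇒0≤q-p : ∀ {p q} → p ≤ q → 0ℚ ≤ q - p
p≤q⇒0≤q-p {p} {q} p≤q = subst (_≤ q - p) (+-inverseʳ p) (+-monoˡ-≤ (- p) p≤q)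

p≤∣p∣ : ∀ p → p ≤ ∣ p ∣
p≤∣p∣ p with ≤-total p 0ℚ
... | inj₁ p≤0 = ≤-trans p≤0 (0≤∣p∣ p)
... | inj₂ 0≤p = ≤-reflexive (sym (0≤p⇒∣p∣≡p 0≤p))

∣p-q∣≡∣q-p∣ : ∀ p q → ∣ p - q ∣ ≡ ∣ q - p ∣
∣p-q∣≡∣q-p∣ p q = trans (sym (∣-p∣≡∣p∣ (p - q))) (cong ∣_∣ (negate p q))
  where
  negate : ∀ p q → - (p - q) ≡ q - p
  negate = solve-∀ ℚ-ring

module ℕ∑ = ListSum ℕ.+-*-commutativeSemiring
open ListSum (CommutativeRing.commutativeSemiring +-*-commutativeRing)

∑-- : ∀ {A : Set} (f g : A → ℚ) xs → ∑ (λ x → f x - g x) xs ≡ ∑ f xs - ∑ g xs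
∑-- f g []       = refl
∑-- f g (x ∷ xs) = trans (cong (λ s → (f x - g x) + s) (∑-- f g xs)) (regroup (f x) (g x) (∑ f xs) (∑ g xs))
  where
  regroup : ∀ a b c d → (a - b) + (c - d) ≡ (a + c) - (b + d)
  regroup = solve-∀ ℚ-ring

∑-mono-≤ : ∀ {A : Set} {f g : A → ℚ} xs → (∀ x → f x ≤ g x) → ∑ f xs ≤ ∑ g xs
∑-mono-≤ []       f≤g = ≤-refl
∑-mono-≤ (x ∷ xs) f≤g = +-mono-≤ (f≤g x) (∑-mono-≤ xs f≤g)

0≤∑ : ∀ {A : Set} {f : A → ℚ} xs → (∀ x → 0ℚ ≤ f x) → 0ℚ ≤ ∑ f xs
0≤∑ xs 0≤f = subst (_≤ ∑ _ xs) (∑-zero xs) (∑-mono-≤ xs 0≤f)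

𝟙 : Bool → ℚ
𝟙 b = if b then 1ℚ else 0ℚ

𝟙-∧ : ∀ a b → 𝟙 (a ∧ b) ≡ 𝟙 a * 𝟙 b
𝟙-∧ true  b = sym (*-identityˡ (𝟙 b))
𝟙-∧ false b = sym (*-zeroˡ (𝟙 b))

0≤𝟙 : ∀ b → 0ℚ ≤ 𝟙 b
0≤𝟙 true  = ℚ.*≤* (ℤ.+≤+ z≤n)
0≤𝟙 false = ≤-refl

∣q-p∣≡±[q-p] : ∀ p q (p≤?q : Dec (p ≤ q)) →
               ∣ q - p ∣ ≡ 𝟙 (does p≤?q) * (q - p) - 𝟙 (not (does p≤?q)) * (q - p)
∣q-p∣≡±[q-p] p q (yes p≤q) = trans (0≤p⇒∣p∣≡p (p≤q⇒0≤q-p p≤q)) (positive (q - p))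
  where
  positive : ∀ x → x ≡ 1ℚ * x - 0ℚ * x
  positive = solve-∀ ℚ-ring
∣q-p∣≡±[q-p] p q (no p≰q) =
  trans (∣p-q∣≡∣q-p∣ q p) (trans (0≤p⇒∣p∣≡p (p≤q⇒0≤q-p (<⇒≤ (≰⇒> p≰q)))) (negative p q))
  where
  negative : ∀ p q → p - q ≡ 0ℚ * (q - p) - 1ℚ * (q - p)
  negative = solve-∀ ℚ-ring

count≡∑ : ∀ {A : Set} (P : A → Bool) xs → count P xs ≡ ℕ∑.∑ (λ x → if P x then 1 else 0) xs
count≡∑ P []       = refl
count≡∑ P (x ∷ xs) = cong (_ ℕ.+_) (count≡∑ P xs)

ℕ→ℚ-count : ∀ {A : Set} (P : A → Bool) xs → ℕ→ℚ (count P xs) ≡ ∑ (λ x → 𝟙 (P x)) xs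
ℕ→ℚ-count P []       = refl
ℕ→ℚ-count P (x ∷ xs) with P x
... | true  = trans (ℕ→ℚ-+ 1 (count P xs)) (cong (1ℚ +_) (ℕ→ℚ-count P xs))
... | false = trans (ℕ→ℚ-+ 0 (count P xs)) (cong (0ℚ +_) (ℕ→ℚ-count P xs))

-- Polynomials

Poly : Set
Poly = List (ℚ × ℕ)

eval : Poly → ℚ → ℚ
eval []            t = 0ℚ
eval ((c , j) ∷ P) t = c * t ^ℚ j + eval P t

derivAt1 : Poly → ℚ
derivAt1 []            = 0ℚ
derivAt1 ((c , j) ∷ P) = c * ℕ→ℚ j + derivAt1 P

DegreeAtMost : ℕ → Poly → Set
DegreeAtMost d = All (λ m → proj₂ m ℕ.≤ d)

-- (c t^j - c a^j) / (t - a)  and  (P(t) - P(a)) / (t - a)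
monomialQuotient : ℚ → ℚ → ℕ → Poly
monomialQuotient c a zero    = []
monomialQuotient c a (suc j) = (c , j) ∷ monomialQuotient (c * a) a j

quotient : Poly → ℚ → Poly
quotient []            a = []
quotient ((c , j) ∷ P) a = monomialQuotient c a j ++ quotient P a

eval-++ : ∀ P Q t → eval (P ++ Q) t ≡ eval P t + eval Q t
eval-++ []            Q t = sym (+-identityˡ (eval Q t))
eval-++ ((c , j) ∷ P) Q t =
  trans (cong (λ e → c * t ^ℚ j + e) (eval-++ P Q t)) (sym (+-assoc (c * t ^ℚ j) (eval P t) (eval Q t)))

monomialQuotient-spec : ∀ c a j t → c * t ^ℚ j - c * a ^ℚ j ≡ (t - a) * eval (monomialQuotient c a j) t
monomialQuotient-spec c a zero    t = trans (+-inverseʳ (c * 1ℚ)) (sym (*-zeroʳ (t - a)))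
monomialQuotient-spec c a (suc j) t = begin
  c * (t * t ^ℚ j) - c * (a * a ^ℚ j)                         ≡⟨ split c t a (t ^ℚ j) (a ^ℚ j) ⟩
  (t - a) * (c * t ^ℚ j) + ((c * a) * t ^ℚ j - (c * a) * a ^ℚ j)
    ≡⟨ cong (λ e → (t - a) * (c * t ^ℚ j) + e) (monomialQuotient-spec (c * a) a j t) ⟩
  (t - a) * (c * t ^ℚ j) + (t - a) * eval (monomialQuotient (c * a) a j) t
    ≡⟨ *-distribˡ-+ (t - a) (c * t ^ℚ j) _ ⟨
  (t - a) * (c * t ^ℚ j + eval (monomialQuotient (c * a) a j) t) ∎
  where
  open ≡-Reasoning
  split : ∀ c t a X Y → c * (t * X) - c * (a * Y) ≡ (t - a) * (c * X) + ((c * a) * X - (c * a) * Y)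
  split = solve-∀ ℚ-ring

quotient-spec : ∀ P a t → eval P t - eval P a ≡ (t - a) * eval (quotient P a) t
quotient-spec []            a t = trans (+-inverseʳ 0ℚ) (sym (*-zeroʳ (t - a)))
quotient-spec ((c , j) ∷ P) a t = begin
  (c * t ^ℚ j + eval P t) - (c * a ^ℚ j + eval P a)
    ≡⟨ regroup (c * t ^ℚ j) (eval P t) (c * a ^ℚ j) (eval P a) ⟩
  (c * t ^ℚ j - c * a ^ℚ j) + (eval P t - eval P a)
    ≡⟨ cong₂ _+_ (monomialQuotient-spec c a j t) (quotient-spec P a t) ⟩
  (t - a) * eval (monomialQuotient c a j) t + (t - a) * eval (quotient P a) t
    ≡⟨ *-distribˡ-+ (t - a) _ _ ⟨
  (t - a) * (eval (monomialQuotient c a j) t + eval (quotient P a) t)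
    ≡⟨ cong ((t - a) *_) (eval-++ (monomialQuotient c a j) (quotient P a) t) ⟨
  (t - a) * eval (monomialQuotient c a j ++ quotient P a) t ∎
  where
  open ≡-Reasoning
  regroup : ∀ x y z w → (x + y) - (z + w) ≡ (x - z) + (y - w)
  regroup = solve-∀ ℚ-ring

monomialQuotient-degree : ∀ d c a j → j ℕ.≤ suc d → DegreeAtMost d (monomialQuotient c a j)
monomialQuotient-degree d c a zero    _         = []
monomialQuotient-degree d c a (suc j) (s≤s j≤d) = j≤d ∷ monomialQuotient-degree d (c * a) a j (ℕ.m≤n⇒m≤1+n j≤d)

quotient-degree : ∀ d P a → DegreeAtMost (suc d) P → DegreeAtMost d (quotient P a)
quotient-degree d []            a []         = []
quotient-degree d ((c , j) ∷ P) a (j≤ ∷ P≤) =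
  All.++⁺ (monomialQuotient-degree d c a j j≤) (quotient-degree d P a P≤)

1^ℚ : ∀ j → 1ℚ ^ℚ j ≡ 1ℚ
1^ℚ zero    = refl
1^ℚ (suc j) = trans (*-identityˡ (1ℚ ^ℚ j)) (1^ℚ j)

monomialQuotient-at-1 : ∀ c j → eval (monomialQuotient c 1ℚ j) 1ℚ ≡ c * ℕ→ℚ j
monomialQuotient-at-1 c zero    = sym (*-zeroʳ c)
monomialQuotient-at-1 c (suc j) = begin
  c * 1ℚ ^ℚ j + eval (monomialQuotient (c * 1ℚ) 1ℚ j) 1ℚ
    ≡⟨ cong₂ (λ u v → c * u + eval (monomialQuotient v 1ℚ j) 1ℚ) (1^ℚ j) (*-identityʳ c) ⟩
  c * 1ℚ + eval (monomialQuotient c 1ℚ j) 1ℚ ≡⟨ cong (c * 1ℚ +_) (monomialQuotient-at-1 c j) ⟩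
  c * 1ℚ + c * ℕ→ℚ j                        ≡⟨ *-distribˡ-+ c 1ℚ (ℕ→ℚ j) ⟨
  c * (1ℚ + ℕ→ℚ j)                          ≡⟨ cong (c *_) (ℕ→ℚ-+ 1 j) ⟨
  c * ℕ→ℚ (suc j)                           ∎
  where open ≡-Reasoning

derivAt1≡quotient-at-1 : ∀ P → derivAt1 P ≡ eval (quotient P 1ℚ) 1ℚ
derivAt1≡quotient-at-1 []            = refl
derivAt1≡quotient-at-1 ((c , j) ∷ P) = sym (begin
  eval (monomialQuotient c 1ℚ j ++ quotient P 1ℚ) 1ℚ
    ≡⟨ eval-++ (monomialQuotient c 1ℚ j) (quotient P 1ℚ) 1ℚ ⟩
  eval (monomialQuotient c 1ℚ j) 1ℚ + eval (quotient P 1ℚ) 1ℚ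
    ≡⟨ cong₂ _+_ (monomialQuotient-at-1 c j) (sym (derivAt1≡quotient-at-1 P)) ⟩
  c * ℕ→ℚ j + derivAt1 P ∎)
  where open ≡-Reasoning

eval-map : ∀ {A : Set} (c : A → ℚ) (j : A → ℕ) as t →
           eval (map (λ a → (c a , j a)) as) t ≡ ∑ (λ a → c a * t ^ℚ j a) as
eval-map c j []       t = refl
eval-map c j (a ∷ as) t = cong (c a * t ^ℚ j a +_) (eval-map c j as t)

derivAt1-map : ∀ {A : Set} (c : A → ℚ) (j : A → ℕ) as →
               derivAt1 (map (λ a → (c a , j a)) as) ≡ ∑ (λ a → c a * ℕ→ℚ (j a)) as
derivAt1-map c j []       = refl
derivAt1-map c j (a ∷ as) = cong (c a * ℕ→ℚ (j a) +_) (derivAt1-map c j as)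

degree0-constant : ∀ P s t → DegreeAtMost 0 P → eval P s ≡ eval P t
degree0-constant []            s t []         = refl
degree0-constant ((c , j) ∷ P) s t (z≤n ∷ P≤) = cong (λ e → c * 1ℚ + e) (degree0-constant P s t P≤)

Separated : ℚ → ℚ → ℚ → Set
Separated N x y = 1ℚ ≤ N * ∣ y - x ∣

divide-bound : ∀ {x q D N F} → 0ℚ ≤ N → x * q ≡ D → 1ℚ ≤ N * ∣ x ∣ → ∣ D ∣ ≤ F → ∣ q ∣ ≤ N * F
divide-bound {x} {q} {D} {N} {F} 0≤N x*q≡D 1≤N∣x∣ ∣D∣≤F = begin
  ∣ q ∣               ≡⟨ *-identityˡ ∣ q ∣ ⟨
  1ℚ * ∣ q ∣          ≤⟨ *-monoʳ-≤-0≤ ∣ q ∣ (0≤∣p∣ q) 1≤N∣x∣ ⟩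
  N * ∣ x ∣ * ∣ q ∣   ≡⟨ *-assoc N ∣ x ∣ ∣ q ∣ ⟩
  N * (∣ x ∣ * ∣ q ∣) ≡⟨ cong (N *_) (∣p*q∣≡∣p∣*∣q∣ x q) ⟨
  N * ∣ x * q ∣       ≡⟨ cong (λ y → N * ∣ y ∣) x*q≡D ⟩
  N * ∣ D ∣           ≤⟨ *-monoˡ-≤-0≤ N 0≤N ∣D∣≤F ⟩
  N * F               ∎
  where open ≤-Reasoning

quotient-bound : ∀ {N E} P a ys → 0ℚ ≤ N → ∣ eval P a ∣ ≤ E → All (Separated N a) ys →
                 All (λ y → ∣ eval P y ∣ ≤ E) ys → All (λ y → ∣ eval (quotient P a) y ∣ ≤ N * (E + E)) ys
quotient-bound {N} {E} P a ys 0≤N ∣Pa∣≤E sep ∣P∣≤E = All.zipWith bound (sep , ∣P∣≤E)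
  where
  bound : ∀ {y} → Separated N a y × ∣ eval P y ∣ ≤ E → ∣ eval (quotient P a) y ∣ ≤ N * (E + E)
  bound {y} (a-y , ∣Py∣≤E) =
    divide-bound {y - a} 0≤N (sym (quotient-spec P a y)) a-y (≤-trans (∣p-q∣≤∣p∣+∣q∣ (eval P y) (eval P a)) (+-mono-≤ ∣Py∣≤E ∣Pa∣≤E))

extrapolationConstant : ℚ → ℕ → ℚ
extrapolationConstant N zero    = 1ℚ
extrapolationConstant N (suc d) = 1ℚ + extrapolationConstant N d * (N + N)

-- Newton's scheme: P(z) = P(a) + (z - a) Q(z) with Q = quotient P a of lower degree,
-- and Q stays bounded on the remaining points because they are separated from a.
extrapolation-bound : ∀ {N E z} d P xs → 0ℚ ≤ N → 0ℚ ≤ E → length xs ≡ suc d → DegreeAtMost d P →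
                      AllPairs (Separated N) xs → All (λ x → ∣ z - x ∣ ≤ 1ℚ) xs →
                      All (λ x → ∣ eval P x ∣ ≤ E) xs → ∣ eval P z ∣ ≤ extrapolationConstant N d * E
extrapolation-bound {E = E} {z} zero P (a ∷ []) _ _ _ P≤ _ _ (∣Pa∣≤E ∷ []) = begin
  ∣ eval P z ∣ ≡⟨ cong ∣_∣ (degree0-constant P z a P≤) ⟩
  ∣ eval P a ∣ ≤⟨ ∣Pa∣≤E ⟩
  E            ≡⟨ *-identityˡ E ⟨
  1ℚ * E       ∎
  where open ≤-Reasoning
extrapolation-bound {N} {E} {z} (suc d) P (a ∷ b ∷ xs) 0≤N 0≤E len P≤
                    (a-sep ∷ sep) (∣z-a∣≤1 ∷ ∣z-xs∣≤1) (∣Pa∣≤E ∷ ∣Pxs∣≤E) = begin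
  ∣ eval P z ∣                           ≡⟨ cong ∣_∣ Newton ⟩
  ∣ eval P a + (z - a) * eval Q z ∣      ≤⟨ ∣p+q∣≤∣p∣+∣q∣ (eval P a) _ ⟩
  ∣ eval P a ∣ + ∣ (z - a) * eval Q z ∣  ≡⟨ cong (∣ eval P a ∣ +_) (∣p*q∣≡∣p∣*∣q∣ (z - a) (eval Q z)) ⟩
  ∣ eval P a ∣ + ∣ z - a ∣ * ∣ eval Q z ∣
    ≤⟨ +-mono-≤ ∣Pa∣≤E (*-mono-≤-0≤ (0≤∣p∣ _) ∣z-a∣≤1 (0≤∣p∣ _) ∣Qz∣≤) ⟩
  E + 1ℚ * (K * (N * (E + E)))           ≡⟨ collect E N K ⟩
  (1ℚ + K * (N + N)) * E                 ∎
  where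
  open ≤-Reasoning
  Q : Poly
  Q = quotient P a
  K : ℚ
  K = extrapolationConstant N d
  Newton : eval P z ≡ eval P a + (z - a) * eval Q z
  Newton = trans (split (eval P z) (eval P a)) (cong (eval P a +_) (quotient-spec P a z))
    where
    split : ∀ x y → x ≡ y + (x - y)
    split = solve-∀ ℚ-ring
  ∣Qz∣≤ : ∣ eval Q z ∣ ≤ K * (N * (E + E))
  ∣Qz∣≤ = extrapolation-bound d Q (b ∷ xs) 0≤N (0≤* 0≤N (0≤+ 0≤E 0≤E)) (ℕ.suc-injective len)
            (quotient-degree d P a P≤) sep ∣z-xs∣≤1 (quotient-bound P a (b ∷ xs) 0≤N ∣Pa∣≤E a-sep ∣Pxs∣≤E)
  collect : ∀ E N K → E + 1ℚ * (K * (N * (E + E))) ≡ (1ℚ + K * (N + N)) * E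
  collect = solve-∀ ℚ-ring

module EquallySpaced (d : ℕ) where
  N : ℚ
  N = ℕ→ℚ (suc d)

  spacing : ℚ
  spacing = ℤ.+ 1 ℚ./ suc d

  point : ℕ → ℚ
  point j = ℕ→ℚ j * spacing

  0≤spacing : 0ℚ ≤ spacing
  0≤spacing = nonNegative⁻¹ spacing {{normalize-nonNeg 1 (suc d)}}

  0≤N : 0ℚ ≤ N
  0≤N = 0≤ℕ→ℚ (suc d)

  N*point : ∀ j → N * point j ≡ ℕ→ℚ j
  N*point j = begin
    N * (ℕ→ℚ j * spacing) ≡⟨ x*[y*z]≡y*[x*z] N (ℕ→ℚ j) spacing ⟩
    ℕ→ℚ j * (N * spacing) ≡⟨ cong (ℕ→ℚ j *_) (ℕ→ℚ-*-inverse (suc d)) ⟩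
    ℕ→ℚ j * 1ℚ      ≡⟨ *-identityʳ (ℕ→ℚ j) ⟩
    ℕ→ℚ j           ∎
    where
    open ≡-Reasoning
    x*[y*z]≡y*[x*z] : ∀ x y z → x * (y * z) ≡ y * (x * z)
    x*[y*z]≡y*[x*z] = solve-∀ ℚ-ring

  point-last : point (suc d) ≡ 1ℚ
  point-last = ℕ→ℚ-*-inverse (suc d)

  0≤point : ∀ j → 0ℚ ≤ point j
  0≤point j = 0≤* (0≤ℕ→ℚ j) 0≤spacing

  point≤1 : ∀ {j} → j ℕ.≤ suc d → point j ≤ 1ℚ
  point≤1 {j} j≤ = subst (point j ≤_) point-last
    (*-monoʳ-≤-0≤ spacing 0≤spacing (ℕ→ℚ-mono-≤ j≤))

  point-separated : ∀ {i j} → i ℕ.< j → Separated N (point i) (point j)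
  point-separated {i} {j} i<j = begin
    1ℚ                          ≡⟨ cancel (ℕ→ℚ i) ⟩
    (1ℚ + ℕ→ℚ i) - ℕ→ℚ i        ≡⟨ cong (_- ℕ→ℚ i) (ℕ→ℚ-+ 1 i) ⟨
    ℕ→ℚ (suc i) - ℕ→ℚ i         ≤⟨ +-monoˡ-≤ (- ℕ→ℚ i) (ℕ→ℚ-mono-≤ i<j) ⟩
    ℕ→ℚ j - ℕ→ℚ i               ≡⟨ cong₂ _-_ (N*point j) (N*point i) ⟨
    N * point j - N * point i   ≡⟨ distrib N (point j) (point i) ⟩
    N * (point j - point i)     ≤⟨ *-monoˡ-≤-0≤ N 0≤N (p≤∣p∣ _) ⟩
    N * ∣ point j - point i ∣   ∎
    where
    open ≤-Reasoning
    cancel : ∀ x → 1ℚ ≡ (1ℚ + x) - x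
    cancel = solve-∀ ℚ-ring
    distrib : ∀ x y z → x * y - x * z ≡ x * (y - z)
    distrib = solve-∀ ℚ-ring

  -- the quotient by t - 1 is P′ at 1, and 1 is the last of the points
  derivAt1-bound : ∀ P {E} → 0ℚ ≤ E → DegreeAtMost (suc d) P →
                   (∀ j → j ℕ.≤ suc d → ∣ eval P (point j) ∣ ≤ E) →
                   ∣ derivAt1 P ∣ ≤ extrapolationConstant N d * (N * (E + E))
  derivAt1-bound P {E} 0≤E P≤ ∣P∣≤E =
    subst (λ x → ∣ x ∣ ≤ _) (sym (derivAt1≡quotient-at-1 P))
      (extrapolation-bound d (quotient P 1ℚ) xs 0≤N (0≤* 0≤N (0≤+ 0≤E 0≤E)) (length-applyUpTo point (suc d))
        (quotient-degree d P 1ℚ P≤)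
        (AllPairs.applyUpTo⁺₁ point (suc d) (λ i<j _ → point-separated i<j))
        (All.applyUpTo⁺₁ point (suc d) λ j<1+d → near-1 (ℕ.<⇒≤ j<1+d))
        (quotient-bound P 1ℚ xs 0≤N (subst (λ x → ∣ eval P x ∣ ≤ E) point-last (∣P∣≤E (suc d) ℕ.≤-refl))
          (All.applyUpTo⁺₁ point (suc d) separated-from-1)
          (All.applyUpTo⁺₁ point (suc d) λ {j} j<1+d → ∣P∣≤E j (ℕ.<⇒≤ j<1+d))))
    where
    xs : List ℚ
    xs = applyUpTo point (suc d)
    near-1 : ∀ {j} → j ℕ.≤ suc d → ∣ 1ℚ - point j ∣ ≤ 1ℚ
    near-1 {j} j≤ = begin
      ∣ 1ℚ - point j ∣ ≡⟨ 0≤p⇒∣p∣≡p (p≤q⇒0≤q-p (point≤1 j≤)) ⟩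
      1ℚ - point j     ≤⟨ +-monoʳ-≤ 1ℚ (neg-antimono-≤ (0≤point j)) ⟩
      1ℚ - 0ℚ          ≡⟨ +-identityʳ 1ℚ ⟩
      1ℚ               ∎
      where open ≤-Reasoning
    separated-from-1 : ∀ {j} → j ℕ.< suc d → Separated N 1ℚ (point j)
    separated-from-1 {j} j<1+d =
      subst (λ x → 1ℚ ≤ N * x) (trans (cong (λ x → ∣ x - point j ∣) point-last) (∣p-q∣≡∣q-p∣ 1ℚ (point j)))
        (point-separated j<1+d)

-- Random subsets

_∈ᵇ_ : ∀ {n} → Fin n → Subset n → Bool
x ∈ᵇ S = does (x ∈? S)

∈ᵇ-⊥ : ∀ {n} (y : Fin n) → y ∈ᵇ ⊥ ≡ false
∈ᵇ-⊥ y = dec-false (y ∈? ⊥) ∉⊥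

∈ᵇ-∪⁅⁆ : ∀ {n} (y x : Fin n) S → y ∈ᵇ (S ∪ ⁅ x ⁆) ≡ y ∈ᵇ S ∨ does (y ≟ x)
∈ᵇ-∪⁅⁆ y x S = does-⇔ (mk⇔ to from) (y ∈? S ∪ ⁅ x ⁆) ((y ∈? S) ⊎-dec (y ≟ x))
  where
  to : y ∈ S ∪ ⁅ x ⁆ → y ∈ S ⊎ y ≡ x
  to y∈ = map₂ (x∈⁅y⁆⇒x≡y x) (x∈p∪q⁻ S ⁅ x ⁆ y∈)
  from : y ∈ S ⊎ y ≡ x → y ∈ S ∪ ⁅ x ⁆
  from (inj₁ y∈S) = x∈p∪q⁺ (inj₁ y∈S)
  from (inj₂ refl) = x∈p∪q⁺ (inj₂ (x∈⁅x⁆ x))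

_∈ᵛ_ : ∀ {n k} → Fin n → Vec (Fin n) k → Bool
x ∈ᵛ v = anyV (λ z → does (z ≟ x)) v

module _ {n : ℕ} where
  allV-cong : ∀ {k} {f g : Fin n → Bool} (v : Vec (Fin n) k) → (∀ y → f y ≡ g y) → allV f v ≡ allV g v
  allV-cong []      f≡g = refl
  allV-cong (y ∷ v) f≡g = cong₂ _∧_ (f≡g y) (allV-cong v f≡g)

  allV-cong-∉ : ∀ {k} {f g : Fin n → Bool} x (v : Vec (Fin n) k) → x ∈ᵛ v ≡ false →
                (∀ y → does (y ≟ x) ≡ false → f y ≡ g y) → allV f v ≡ allV g v
  allV-cong-∉ x []      _   f≡g = refl
  allV-cong-∉ x (y ∷ v) x∉v f≡g with y ≟ x
  ... | no y≢x = cong₂ _∧_ (f≡g y (dec-false (y ≟ x) y≢x)) (allV-cong-∉ x v x∉v f≡g)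

  allV-∈ : ∀ {k} {f : Fin n → Bool} x (v : Vec (Fin n) k) → x ∈ᵛ v ≡ true → f x ≡ false → allV f v ≡ false
  allV-∈ {f = f} x (y ∷ v) x∈v fx≡false with y ≟ x
  ... | yes refl = cong (_∧ allV f v) fx≡false
  ... | no _     = trans (cong (f y ∧_) (allV-∈ x v x∈v fx≡false)) (Bool.∧-zeroʳ (f y))

module RandomSubset {n : ℕ} (coin kept : Fin n → Bool) where
  open import Data.List.Membership.DecPropositional (_≟_ {n}) using () renaming (_∈?_ to _∈ˡ?_)

  elem : Fin n → List (Fin n) → Bool
  elem y xs = does (y ∈ˡ? xs)

  elem-allFin : ∀ y → elem y (allFin n) ≡ true
  elem-allFin y = dec-true (y ∈ˡ? allFin n) (∈-allFin y)

  reachable : Subset n → List (Fin n) → Fin n → Bool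
  reachable S xs y = y ∈ᵇ S ∨ (elem y xs ∧ (coin y ∨ kept y))

  coinCount : ∀ {k} → List (Fin n) → Vec (Fin n) k → ℕ
  coinCount xs v = count (λ x → coin x ∧ x ∈ᵛ v) xs

  record Disjoint (S : Subset n) (xs : List (Fin n)) : Set where
    constructor disjoint
    field ∉S : ∀ y → elem y xs ≡ true → y ∈ᵇ S ≡ false
  open Disjoint

  module _ {S : Subset n} {x : Fin n} {xs : List (Fin n)} (S#x∷xs : Disjoint S (x ∷ xs)) where
    head∉ : x ∈ᵇ S ≡ false
    head∉ = ∉S S#x∷xs x (cong (_∨ elem x xs) (dec-true (x ≟ x) refl))

    Disjoint-tail : Disjoint S xs
    Disjoint-tail = disjoint λ y y∈xs → ∉S S#x∷xs y (trans (cong (does (y ≟ x) ∨_) y∈xs) (Bool.∨-zeroʳ _))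

    Disjoint-∪⁅⁆ : elem x xs ≡ false → Disjoint (S ∪ ⁅ x ⁆) xs
    Disjoint-∪⁅⁆ x∉xs = disjoint ∉S∪⁅x⁆
      where
      ∉S∪⁅x⁆ : ∀ y → elem y xs ≡ true → y ∈ᵇ (S ∪ ⁅ x ⁆) ≡ false
      ∉S∪⁅x⁆ y y∈xs with y ≟ x | ∈ᵇ-∪⁅⁆ y x S
      ... | yes refl | _  = contradiction (trans (sym y∈xs) x∉xs) λ ()
      ... | no _     | eq = trans eq (trans (Bool.∨-identityʳ _) (∉S Disjoint-tail y y∈xs))

    reachable-∪⁅⁆ : coin x ∨ kept x ≡ true → ∀ y → reachable (S ∪ ⁅ x ⁆) xs y ≡ reachable S (x ∷ xs) y
    reachable-∪⁅⁆ present y rewrite ∈ᵇ-∪⁅⁆ y x S with y ≟ x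
    ... | yes refl rewrite head∉ | present = refl
    ... | no _     = cong (_∨ (elem y xs ∧ (coin y ∨ kept y))) (Bool.∨-identityʳ (y ∈ᵇ S))

    reachable-head : elem x xs ≡ false → reachable S xs x ≡ false
    reachable-head x∉xs rewrite head∉ | x∉xs = refl

    reachable-∷ : ∀ y → does (y ≟ x) ≡ false → reachable S xs y ≡ reachable S (x ∷ xs) y
    reachable-∷ y y≢x rewrite y≢x = refl

    reachable-absent : elem x xs ≡ false → coin x ∨ kept x ≡ false →
                       ∀ y → reachable S xs y ≡ reachable S (x ∷ xs) y
    reachable-absent x∉xs absent y with y ≟ x
    ... | yes refl rewrite head∉ | x∉xs | absent = refl
    ... | no _     = refl

  unique-head : ∀ {x xs} → Unique (x ∷ xs) → elem x xs ≡ false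
  unique-head {x} {xs} (x≢xs AllPairs.∷ _) = dec-false (x ∈ˡ? xs) (All.All¬⇒¬Any x≢xs)

  indicator : ∀ {k} → Vec (Fin n) k → Subset n → ℚ
  indicator v S = 𝟙 (allV (_∈ᵇ S) v)

  module _ (t : ℚ) where
    -- E[F (S ∪ X)] for the random X ⊆ xs containing each x with coin x independently with
    -- probability t, and each other x exactly when kept x
    expect : List (Fin n) → Subset n → (Subset n → ℚ) → ℚ
    expect []       S F = F S
    expect (x ∷ xs) S F =
      if coin x then t * expect xs (S ∪ ⁅ x ⁆) F + (1ℚ - t) * expect xs S F
      else if kept x then expect xs (S ∪ ⁅ x ⁆) F
      else expect xs S F

    expect-cong : ∀ xs S {F G : Subset n → ℚ} → (∀ S → F S ≡ G S) → expect xs S F ≡ expect xs S G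
    expect-cong []       S F≡G = F≡G S
    expect-cong (x ∷ xs) S F≡G with coin x | kept x
    ... | true  | _     = cong₂ (λ a b → t * a + (1ℚ - t) * b) (expect-cong xs _ F≡G) (expect-cong xs S F≡G)
    ... | false | true  = expect-cong xs _ F≡G
    ... | false | false = expect-cong xs S F≡G

    expect-linear : ∀ {A : Set} xs S (c : A → ℚ) (G : A → Subset n → ℚ) as →
                    expect xs S (λ S → ∑ (λ a → c a * G a S) as) ≡ ∑ (λ a → c a * expect xs S (G a)) as
    expect-linear []       S c G as = refl
    expect-linear {A} (x ∷ xs) S c G as with coin x | kept x
    ... | false | true  = expect-linear xs _ c G as
    ... | false | false = expect-linear xs S c G as
    ... | true  | _     = begin
      t * expect xs S′ (λ S → ∑ (λ a → c a * G a S) as) + (1ℚ - t) * expect xs S (λ S → ∑ (λ a → c a * G a S) as)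
        ≡⟨ cong₂ (λ a b → t * a + (1ℚ - t) * b) (expect-linear xs S′ c G as) (expect-linear xs S c G as) ⟩
      t * ∑ (λ a → c a * E₁ a) as + (1ℚ - t) * ∑ (λ a → c a * E₀ a) as
        ≡⟨ cong₂ _+_ (∑-*ˡ t _ as) (∑-*ˡ (1ℚ - t) _ as) ⟨
      ∑ (λ a → t * (c a * E₁ a)) as + ∑ (λ a → (1ℚ - t) * (c a * E₀ a)) as
        ≡⟨ ∑-+ _ _ as ⟨
      ∑ (λ a → t * (c a * E₁ a) + (1ℚ - t) * (c a * E₀ a)) as
        ≡⟨ ∑-cong as (λ a → factor t (c a) (E₁ a) (E₀ a)) ⟩
      ∑ (λ a → c a * (t * E₁ a + (1ℚ - t) * E₀ a)) as ∎
      where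
      open ≡-Reasoning
      S′ : Subset n
      S′ = S ∪ ⁅ x ⁆
      E₁ E₀ : A → ℚ
      E₁ a = expect xs S′ (G a)
      E₀ a = expect xs S (G a)
      factor : ∀ t c a b → t * (c * a) + (1ℚ - t) * (c * b) ≡ c * (t * a + (1ℚ - t) * b)
      factor = solve-∀ ℚ-ring

    expect-bound : 0ℚ ≤ t → t ≤ 1ℚ → ∀ xs S {F E} → (∀ S → ∣ F S ∣ ≤ E) → ∣ expect xs S F ∣ ≤ E
    expect-bound 0≤t t≤1 []       S ∣F∣≤E = ∣F∣≤E S
    expect-bound 0≤t t≤1 (x ∷ xs) S {F} {E} ∣F∣≤E with coin x | kept x
    ... | false | true  = expect-bound 0≤t t≤1 xs _ ∣F∣≤E
    ... | false | false = expect-bound 0≤t t≤1 xs S ∣F∣≤E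
    ... | true  | _     = begin
      ∣ t * a + (1ℚ - t) * b ∣         ≤⟨ ∣p+q∣≤∣p∣+∣q∣ (t * a) ((1ℚ - t) * b) ⟩
      ∣ t * a ∣ + ∣ (1ℚ - t) * b ∣     ≡⟨ cong₂ _+_ (∣p*q∣≡∣p∣*∣q∣ t a) (∣p*q∣≡∣p∣*∣q∣ (1ℚ - t) b) ⟩
      ∣ t ∣ * ∣ a ∣ + ∣ 1ℚ - t ∣ * ∣ b ∣ ≡⟨ cong₂ (λ u v → u * ∣ a ∣ + v * ∣ b ∣) (0≤p⇒∣p∣≡p 0≤t) (0≤p⇒∣p∣≡p 0≤1-t) ⟩
      t * ∣ a ∣ + (1ℚ - t) * ∣ b ∣
        ≤⟨ +-mono-≤ (*-monoˡ-≤-0≤ t 0≤t (expect-bound 0≤t t≤1 xs _ ∣F∣≤E))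
                    (*-monoˡ-≤-0≤ (1ℚ - t) 0≤1-t (expect-bound 0≤t t≤1 xs S ∣F∣≤E)) ⟩
      t * E + (1ℚ - t) * E              ≡⟨ convex t E ⟩
      E                                 ∎
      where
      open ≤-Reasoning
      a b : ℚ
      a = expect xs (S ∪ ⁅ x ⁆) F
      b = expect xs S F
      0≤1-t : 0ℚ ≤ 1ℚ - t
      0≤1-t = p≤q⇒0≤q-p t≤1
      convex : ∀ t E → t * E + (1ℚ - t) * E ≡ E
      convex = solve-∀ ℚ-ring

    coin-flip-step : ∀ {S x xs k} (v : Vec (Fin n) k) → Disjoint S (x ∷ xs) → elem x xs ≡ false → ∀ b → x ∈ᵛ v ≡ b →
                     let R = allV (reachable S (x ∷ xs)) v ; T = t ^ℚ coinCount xs v in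
                     t * (𝟙 R * T) + (1ℚ - t) * (𝟙 (allV (reachable S xs) v) * T)
                     ≡ 𝟙 R * t ^ℚ ((if b then 1 else 0) ℕ.+ coinCount xs v)
    coin-flip-step {S} {x} {xs} v S#x∷xs x∉xs true x∈v = begin
      t * (𝟙 R * T) + (1ℚ - t) * (𝟙 (allV (reachable S xs) v) * T)
        ≡⟨ cong (λ a → t * (𝟙 R * T) + (1ℚ - t) * (𝟙 a * T)) (allV-∈ x v x∈v (reachable-head S#x∷xs x∉xs)) ⟩
      t * (𝟙 R * T) + (1ℚ - t) * (0ℚ * T)   ≡⟨ x-taken t (𝟙 R) T ⟩
      𝟙 R * (t * T)                          ∎
      where
      open ≡-Reasoning
      R : Bool
      R = allV (reachable S (x ∷ xs)) v
      T : ℚ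
      T = t ^ℚ coinCount xs v
      x-taken : ∀ t a T → t * (a * T) + (1ℚ - t) * (0ℚ * T) ≡ a * (t * T)
      x-taken = solve-∀ ℚ-ring
    coin-flip-step {S} {x} {xs} v S#x∷xs x∉xs false x∉v = begin
      t * (𝟙 R * T) + (1ℚ - t) * (𝟙 (allV (reachable S xs) v) * T)
        ≡⟨ cong (λ a → t * (𝟙 R * T) + (1ℚ - t) * (𝟙 a * T)) (allV-cong-∉ x v x∉v (reachable-∷ S#x∷xs)) ⟩
      t * (𝟙 R * T) + (1ℚ - t) * (𝟙 R * T)   ≡⟨ x-irrelevant t (𝟙 R) T ⟩
      𝟙 R * T                                 ∎
      where
      open ≡-Reasoning
      R : Bool
      R = allV (reachable S (x ∷ xs)) v
      T : ℚ
      T = t ^ℚ coinCount xs v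
      x-irrelevant : ∀ t a T → t * (a * T) + (1ℚ - t) * (a * T) ≡ a * T
      x-irrelevant = solve-∀ ℚ-ring

    expect-indicator : ∀ xs S {k} (v : Vec (Fin n) k) → Unique xs → Disjoint S xs →
                       expect xs S (indicator v) ≡ 𝟙 (allV (reachable S xs) v) * t ^ℚ coinCount xs v
    expect-indicator [] S v _ _ =
      trans (cong 𝟙 (allV-cong v (λ y → sym (Bool.∨-identityʳ (y ∈ᵇ S))))) (sym (*-identityʳ _))
    expect-indicator (x ∷ xs) S v uniq@(_ AllPairs.∷ uniq′) S#x∷xs
      with coin x in coin-x | kept x in kept-x
    ... | false | true  = trans (expect-indicator xs _ v uniq′ (Disjoint-∪⁅⁆ S#x∷xs (unique-head uniq)))
                               (cong (λ b → 𝟙 b * _) (allV-cong v (reachable-∪⁅⁆ S#x∷xs (cong₂ _∨_ coin-x kept-x))))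
    ... | false | false = trans (expect-indicator xs S v uniq′ (Disjoint-tail S#x∷xs))
                               (cong (λ b → 𝟙 b * _) (allV-cong v
                                 (reachable-absent S#x∷xs (unique-head uniq) (cong₂ _∨_ coin-x kept-x))))
    ... | true  | _ = begin
      t * expect xs S′ (indicator v) + (1ℚ - t) * expect xs S (indicator v)
        ≡⟨ cong₂ (λ a b → t * a + (1ℚ - t) * b)
                 (expect-indicator xs S′ v uniq′ (Disjoint-∪⁅⁆ S#x∷xs (unique-head uniq)))
                 (expect-indicator xs S v uniq′ (Disjoint-tail S#x∷xs)) ⟩
      t * (𝟙 (allV (reachable S′ xs) v) * T) + (1ℚ - t) * (𝟙 (allV (reachable S xs) v) * T)
        ≡⟨ cong (λ a → t * (𝟙 a * T) + (1ℚ - t) * (𝟙 (allV (reachable S xs) v) * T))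
                (allV-cong v (reachable-∪⁅⁆ S#x∷xs (cong (_∨ kept x) coin-x))) ⟩
      t * (𝟙 R * T) + (1ℚ - t) * (𝟙 (allV (reachable S xs) v) * T)
        ≡⟨ coin-flip-step v S#x∷xs (unique-head uniq) (x ∈ᵛ v) refl ⟩
      𝟙 R * t ^ℚ ((if x ∈ᵛ v then 1 else 0) ℕ.+ coinCount xs v) ∎
      where
      open ≡-Reasoning
      S′ : Subset n
      S′ = S ∪ ⁅ x ⁆
      T : ℚ
      T = t ^ℚ coinCount xs v
      R : Bool
      R = allV (reachable S (x ∷ xs)) v

-- Counting tuples

module _ {A : Set} where
  count-cong : ∀ {P Q : A → Bool} xs → (∀ x → P x ≡ Q x) → count P xs ≡ count Q xs
  count-cong []       P≡Q = refl
  count-cong (x ∷ xs) P≡Q = cong₂ (λ b c → (if b then 1 else 0) ℕ.+ c) (P≡Q x) (count-cong xs P≡Q)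

  count-false : ∀ xs → count (λ (_ : A) → false) xs ≡ 0
  count-false []       = refl
  count-false (x ∷ xs) = count-false xs

  count-split : ∀ (P Q : A → Bool) xs → count (λ x → P x ∧ Q x) xs ℕ.+ count (λ x → P x ∧ not (Q x)) xs ≡ count P xs
  count-split P Q []       = refl
  count-split P Q (x ∷ xs) with P x | Q x
  ... | true  | true  = cong suc (count-split P Q xs)
  ... | true  | false = trans (ℕ.+-suc _ _) (cong suc (count-split P Q xs))
  ... | false | _     = count-split P Q xs

  count-mono : ∀ {P Q : A → Bool} xs → (∀ x → P x ≡ true → Q x ≡ true) → count P xs ℕ.≤ count Q xs
  count-mono []       P⇒Q = z≤n
  count-mono {P} {Q} (x ∷ xs) P⇒Q with P x in Px | Q x in Qx
  ... | true  | true  = s≤s (count-mono xs P⇒Q)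
  ... | true  | false = contradiction (trans (sym (P⇒Q x Px)) Qx) λ ()
  ... | false | true  = ℕ.m≤n⇒m≤1+n (count-mono xs P⇒Q)
  ... | false | false = count-mono xs P⇒Q

  count-∨ : ∀ (P Q : A → Bool) xs → count (λ x → P x ∨ Q x) xs ℕ.≤ count P xs ℕ.+ count Q xs
  count-∨ P Q []       = z≤n
  count-∨ P Q (x ∷ xs) with P x | Q x
  ... | true  | true  = s≤s (ℕ.≤-trans (count-∨ P Q xs) (ℕ.+-monoʳ-≤ (count P xs) (ℕ.n≤1+n _)))
  ... | true  | false = s≤s (count-∨ P Q xs)
  ... | false | true  = ℕ.≤-trans (s≤s (count-∨ P Q xs)) (ℕ.≤-reflexive (sym (ℕ.+-suc _ _)))
  ... | false | false = count-∨ P Q xs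

module _ {A B : Set} where
  count-map : ∀ (P : B → Bool) (f : A → B) xs → count P (map f xs) ≡ count (λ x → P (f x)) xs
  count-map P f []       = refl
  count-map P f (x ∷ xs) = cong (_ ℕ.+_) (count-map P f xs)

  count-concatMap : ∀ (P : B → Bool) (f : A → List B) xs →
                    count P (concatMap f xs) ≡ ℕ∑.∑ (λ x → count P (f x)) xs
  count-concatMap P f xs = begin
    count P (concatMap f xs)                                     ≡⟨ count≡∑ P (concatMap f xs) ⟩
    ℕ∑.∑ (λ y → if P y then 1 else 0) (concatMap f xs)          ≡⟨ ℕ∑.∑-concatMap _ f xs ⟩
    ℕ∑.∑ (λ x → ℕ∑.∑ (λ y → if P y then 1 else 0) (f x)) xs     ≡⟨ ℕ∑.∑-cong xs (λ x → sym (count≡∑ P (f x))) ⟩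
    ℕ∑.∑ (λ x → count P (f x)) xs                                ∎
    where open ≡-Reasoning

module _ {n : ℕ} where
  count-tuples-suc : ∀ k (P : Vec (Fin n) (suc k) → Bool) →
                     count P (tuples (suc k)) ≡ ℕ∑.∑ (λ x → count (λ v → P (x ∷ v)) (tuples k)) (allFin n)
  count-tuples-suc k P =
    trans (count-concatMap P _ (allFin n)) (ℕ∑.∑-cong (allFin n) (λ x → count-map P (x ∷_) (tuples k)))

  allV-∧ : ∀ {k} (f g : Fin n → Bool) (v : Vec (Fin n) k) → allV (λ y → f y ∧ g y) v ≡ allV f v ∧ allV g v
  allV-∧ f g []      = refl
  allV-∧ f g (y ∷ v) rewrite allV-∧ f g v with f y | g y
  ... | true  | true  = refl
  ... | true  | false = sym (Bool.∧-zeroʳ _)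
  ... | false | _     = refl

  not-∈ᵛ : ∀ {k} x (v : Vec (Fin n) k) → not (x ∈ᵛ v) ≡ allV (λ y → not (does (y ≟ x))) v
  not-∈ᵛ x []      = refl
  not-∈ᵛ x (y ∷ v) with does (y ≟ x)
  ... | true  = refl
  ... | false = not-∈ᵛ x v

count-allFin-suc : ∀ {n} (P : Fin (suc n) → Bool) →
                   count P (allFin (suc n)) ≡ (if P zero then 1 else 0) ℕ.+ count (λ x → P (suc x)) (allFin n)
count-allFin-suc {n} P = cong ((if P zero then 1 else 0) ℕ.+_)
  (trans (cong (count P) (sym (map-tabulate (λ x → x) suc))) (count-map P suc (allFin n)))

count-∈ᵇ : ∀ {n} (U : Subset n) → count (_∈ᵇ U) (allFin n) ≡ ∣ U ∣ˢ
count-∈ᵇ []      = refl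
count-∈ᵇ (b ∷ U) rewrite count-allFin-suc (_∈ᵇ (b ∷ U)) | count-∈ᵇ U with b
... | true  = refl
... | false = refl

count-≟ : ∀ {n} (x : Fin n) → count (λ z → does (z ≟ x)) (allFin n) ≡ 1
count-≟ {suc n} zero    = trans (count-allFin-suc {n} (λ z → does (z ≟ zero))) (cong suc (count-false (allFin n)))
count-≟ {suc n} (suc x) = trans (count-allFin-suc {n} (λ z → does (z ≟ suc x))) (count-≟ x)

module _ {n : ℕ} where
  ∑-if≡count* : ∀ (P : Fin n → Bool) c xs → ℕ∑.∑ (λ x → if P x then c else 0) xs ≡ count P xs ℕ.* c
  ∑-if≡count* P c []       = refl
  ∑-if≡count* P c (x ∷ xs) with P x
  ... | true  = cong (c ℕ.+_) (∑-if≡count* P c xs)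
  ... | false = ∑-if≡count* P c xs

  count-allV : ∀ k (P : Fin n → Bool) → count (allV P) (tuples k) ≡ count P (allFin n) ℕ.^ k
  count-allV zero    P = refl
  count-allV (suc k) P = begin
    count (allV P) (tuples (suc k))                                   ≡⟨ count-tuples-suc k (allV P) ⟩
    ℕ∑.∑ (λ x → count (λ v → P x ∧ allV P v) (tuples k)) (allFin n)  ≡⟨ ℕ∑.∑-cong (allFin n) (λ x → first (P x)) ⟩
    ℕ∑.∑ (λ x → if P x then count P (allFin n) ℕ.^ k else 0) (allFin n) ≡⟨ ∑-if≡count* P _ (allFin n) ⟩
    count P (allFin n) ℕ.^ suc k                                       ∎
    where
    open ≡-Reasoning
    first : ∀ b → count (λ v → b ∧ allV P v) (tuples k) ≡ (if b then count P (allFin n) ℕ.^ k else 0)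
    first true  = count-allV k P
    first false = count-false (tuples k)

  count-allV-∈ᵛ : ∀ k (P : Fin n → Bool) x →
                  count (λ v → allV P v ∧ x ∈ᵛ v) (tuples k) ℕ.+ count (λ z → P z ∧ not (does (z ≟ x))) (allFin n) ℕ.^ k
                  ≡ count P (allFin n) ℕ.^ k
  count-allV-∈ᵛ k P x = begin
    count (λ v → allV P v ∧ x ∈ᵛ v) (tuples k) ℕ.+ count P∖x (allFin n) ℕ.^ k
      ≡⟨ cong (count (λ v → allV P v ∧ x ∈ᵛ v) (tuples k) ℕ.+_) (sym (count-allV k P∖x)) ⟩
    count (λ v → allV P v ∧ x ∈ᵛ v) (tuples k) ℕ.+ count (allV P∖x) (tuples k)
      ≡⟨ cong (count (λ v → allV P v ∧ x ∈ᵛ v) (tuples k) ℕ.+_) (count-cong (tuples k) avoids-x) ⟩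
    count (λ v → allV P v ∧ x ∈ᵛ v) (tuples k) ℕ.+ count (λ v → allV P v ∧ not (x ∈ᵛ v)) (tuples k)
      ≡⟨ count-split (allV P) (x ∈ᵛ_) (tuples k) ⟩
    count (allV P) (tuples k)
      ≡⟨ count-allV k P ⟩
    count P (allFin n) ℕ.^ k ∎
    where
    open ≡-Reasoning
    P∖x : Fin n → Bool
    P∖x z = P z ∧ not (does (z ≟ x))
    avoids-x : ∀ v → allV P∖x v ≡ allV P v ∧ not (x ∈ᵛ v)
    avoids-x v = trans (allV-∧ P _ v) (cong (allV P v ∧_) (sym (not-∈ᵛ x v)))

  count-remove : ∀ (P : Fin n → Bool) x → P x ≡ true →
                 suc (count (λ z → P z ∧ not (does (z ≟ x))) (allFin n)) ≡ count P (allFin n)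
  count-remove P x Px = trans (cong (ℕ._+ count (λ z → P z ∧ not (does (z ≟ x))) (allFin n)) (sym only-x)) (count-split P (λ z → does (z ≟ x)) (allFin n))
    where
    only-x : count (λ z → P z ∧ does (z ≟ x)) (allFin n) ≡ 1
    only-x = trans (count-cong (allFin n) at-x) (count-≟ x)
      where
      at-x : ∀ z → P z ∧ does (z ≟ x) ≡ does (z ≟ x)
      at-x z with z ≟ x
      ... | yes refl = trans (Bool.∧-identityʳ (P z)) Px
      ... | no _     = Bool.∧-zeroʳ (P z)

  coinCount-bound : ∀ (c : Fin n → Bool) {k} (v : Vec (Fin n) k) → count (λ x → c x ∧ x ∈ᵛ v) (allFin n) ℕ.≤ k
  coinCount-bound c []      = ℕ.≤-reflexive (trans (count-cong (allFin n) (λ x → Bool.∧-zeroʳ (c x))) (count-false (allFin n)))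
  coinCount-bound c {suc k} (y ∷ v) = begin
    count (λ x → c x ∧ (does (y ≟ x) ∨ x ∈ᵛ v)) (allFin n)
      ≤⟨ count-mono (allFin n) (λ x → weaken x (y ≟ x)) ⟩
    count (λ x → does (x ≟ y) ∨ (c x ∧ x ∈ᵛ v)) (allFin n)
      ≤⟨ count-∨ (λ x → does (x ≟ y)) (λ x → c x ∧ x ∈ᵛ v) (allFin n) ⟩
    count (λ x → does (x ≟ y)) (allFin n) ℕ.+ count (λ x → c x ∧ x ∈ᵛ v) (allFin n)
      ≤⟨ ℕ.+-mono-≤ (ℕ.≤-reflexive (count-≟ y)) (coinCount-bound c v) ⟩
    suc k ∎
    where
    open ℕ.≤-Reasoning
    weaken : ∀ x (y≟x : Dec (y ≡ x)) → c x ∧ (does y≟x ∨ x ∈ᵛ v) ≡ true → does (x ≟ y) ∨ (c x ∧ x ∈ᵛ v) ≡ true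
    weaken x (yes refl) _ = cong (_∨ (c x ∧ x ∈ᵛ v)) (dec-true (x ≟ x) refl)
    weaken x (no _)     h = trans (cong (does (x ≟ y) ∨_) h) (Bool.∨-zeroʳ _)

open PowerBounds

-- Sorting cliques

<ᵇ-true : ∀ {m n} → m ℕ.< n → (m <ᵇ n) ≡ true
<ᵇ-true m<n = Equivalence.to Bool.T-≡ (ℕ.<⇒<ᵇ m<n)

<ᵇ⇒< : ∀ {m n} → (m <ᵇ n) ≡ true → m ℕ.< n
<ᵇ⇒< {m} {n} m<ᵇn = ℕ.<ᵇ⇒< m n (Equivalence.from Bool.T-≡ m<ᵇn)

<ᵇ-false : ∀ {m n} → n ℕ.≤ m → (m <ᵇ n) ≡ false
<ᵇ-false {m} {n} n≤m with m <ᵇ n in m<ᵇn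
... | false = refl
... | true  = contradiction (<ᵇ⇒< m<ᵇn) (ℕ.≤⇒≯ n≤m)

module Sorting {n : ℕ} (R : Fin n → Fin n → Bool)
               (R-sym : ∀ x y → R x y ≡ R y x) (R-irrefl : ∀ x → R x x ≡ false) where

  _<ᶠ_ : Fin n → Fin n → Bool
  y <ᶠ z = toℕ y <ᵇ toℕ z

  -- R-cliques of size k inside P, as ordered tuples and as increasing tuples,
  -- counted by their first entry
  ordered : ℕ → (Fin n → Bool) → ℕ
  ordered zero    P = 1
  ordered (suc k) P = ℕ∑.∑ (λ z → if P z then ordered k (λ w → P w ∧ R z w) else 0) (allFin n)

  increasing : ℕ → (Fin n → Bool) → ℕ
  increasing zero    P = 1
  increasing (suc k) P = ℕ∑.∑ (λ z → if P z then increasing k (λ w → P w ∧ (R z w ∧ z <ᶠ w)) else 0) (allFin n)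

  -- increasing k-cliques together with a vertex adjacent to all of them
  marked : ℕ → (Fin n → Bool) → ℕ
  marked k P = ℕ∑.∑ (λ y → if P y then increasing k (λ w → P w ∧ R y w) else 0) (allFin n)

  increasing-cong : ∀ k {P Q} → (∀ w → P w ≡ Q w) → increasing k P ≡ increasing k Q
  increasing-cong zero    P≡Q = refl
  increasing-cong (suc k) {P} {Q} P≡Q = ℕ∑.∑-cong (allFin n) λ z → first z (P≡Q z)
    where
    first : ∀ z → P z ≡ Q z → (if P z then increasing k (λ w → P w ∧ (R z w ∧ z <ᶠ w)) else 0)
                             ≡ (if Q z then increasing k (λ w → Q w ∧ (R z w ∧ z <ᶠ w)) else 0)
    first z Pz≡Qz with P z | Q z
    ... | true  | true  = increasing-cong k (λ w → cong (_∧ (R z w ∧ z <ᶠ w)) (P≡Q w))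
    ... | false | false = refl

  -- a pair y ≠ z of adjacent vertices is either increasing or decreasing
  split-pair : ∀ k (P : Fin n → Bool) y z →
    (if P y then (if P z ∧ R y z then increasing k (λ w → (P w ∧ R y w) ∧ (R z w ∧ z <ᶠ w)) else 0) else 0)
    ≡ (if P y then (if P z ∧ (R y z ∧ y <ᶠ z)
                    then increasing k (λ w → (P w ∧ (R y w ∧ y <ᶠ w)) ∧ (R z w ∧ z <ᶠ w)) else 0) else 0)
      ℕ.+ (if P z then (if P y ∧ (R z y ∧ z <ᶠ y)
                        then increasing k (λ w → (P w ∧ (R z w ∧ z <ᶠ w)) ∧ R y w) else 0) else 0)
  split-pair k P y z with P y | P z | R y z in Ryz
  ... | false | false | _     = refl
  ... | false | true  | _     = refl
  ... | true  | false | _     = refl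
  ... | true  | true  | false rewrite R-sym z y | Ryz = refl
  ... | true  | true  | true  with ℕ.<-cmp (toℕ y) (toℕ z)
  ...   | tri< y<z _ _ rewrite R-sym z y | Ryz | <ᵇ-true y<z | <ᵇ-false (ℕ.<⇒≤ y<z) =
    trans (increasing-cong k λ w → later-than-z (P w) (R y w) (R z w) (z <ᶠ w) (y <ᶠ w)
                                     (λ z<w → <ᵇ-true (ℕ.<-trans y<z (<ᵇ⇒< {n = toℕ w} z<w))))
          (sym (ℕ.+-identityʳ _))
    where
    later-than-z : ∀ p a b c d → (c ≡ true → d ≡ true) → (p ∧ a) ∧ (b ∧ c) ≡ (p ∧ (a ∧ d)) ∧ (b ∧ c)
    later-than-z p a b true  d c⇒d rewrite c⇒d refl | Bool.∧-identityʳ a = refl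
    later-than-z p a b false d c⇒d rewrite Bool.∧-zeroʳ b | Bool.∧-zeroʳ (p ∧ a) | Bool.∧-zeroʳ (p ∧ (a ∧ d)) = refl
  ...   | tri≈ _ y≡z _ =
    contradiction (trans (sym (subst (λ x → R y x ≡ true) (sym (Fin.toℕ-injective y≡z)) Ryz)) (R-irrefl y)) λ ()
  ...   | tri> _ _ z<y rewrite R-sym z y | Ryz | <ᵇ-true z<y | <ᵇ-false (ℕ.<⇒≤ z<y) =
    increasing-cong k λ w → reorder (P w) (R y w) (R z w) (z <ᶠ w)
    where
    reorder : ∀ p a b c → (p ∧ a) ∧ (b ∧ c) ≡ (p ∧ (b ∧ c)) ∧ a
    reorder true  true  b c = sym (Bool.∧-identityʳ _)
    reorder true  false b c = sym (Bool.∧-zeroʳ _)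
    reorder false a     b c = refl

  if-* : ∀ b c x → (if b then c ℕ.* x else 0) ≡ c ℕ.* (if b then x else 0)
  if-* true  c x = refl
  if-* false c x = sym (ℕ.*-zeroʳ c)

  marked≡ : ∀ k (P : Fin n → Bool) → marked k P ≡ suc k ℕ.* increasing (suc k) P
  marked≡ zero    P = sym (ℕ.+-identityʳ _)
  marked≡ (suc k) P = begin
    marked (suc k) P
      ≡⟨ ℕ∑.∑-cong V (λ y → trans (ℕ∑.∑-if (P y) _ V)
                               (trans (ℕ∑.∑-cong V (split-pair k P y)) (ℕ∑.∑-+ (A y) (B y) V))) ⟩
    ℕ∑.∑ (λ y → ℕ∑.∑ (A y) V ℕ.+ ℕ∑.∑ (B y) V) V
      ≡⟨ ℕ∑.∑-+ (λ y → ℕ∑.∑ (A y) V) (λ y → ℕ∑.∑ (B y) V) V ⟩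
    ℕ∑.∑ (λ y → ℕ∑.∑ (A y) V) V ℕ.+ ℕ∑.∑ (λ y → ℕ∑.∑ (B y) V) V
      ≡⟨ cong₂ ℕ._+_ (ℕ∑.∑-cong V (λ y → sym (ℕ∑.∑-if (P y) _ V))) (ℕ∑.∑-swap B V V) ⟩
    increasing (suc (suc k)) P ℕ.+ ℕ∑.∑ (λ z → ℕ∑.∑ (λ y → B y z) V) V
      ≡⟨ cong (increasing (suc (suc k)) P ℕ.+_) (ℕ∑.∑-cong V λ z →
           trans (sym (ℕ∑.∑-if (P z) _ V))
                 (trans (cong (λ m → if P z then m else 0) (marked≡ k (λ w → P w ∧ (R z w ∧ z <ᶠ w))))
                        (if-* (P z) (suc k) _))) ⟩
    increasing (suc (suc k)) P ℕ.+ ℕ∑.∑ (λ z → suc k ℕ.* (if P z then increasing (suc k) (λ w → P w ∧ (R z w ∧ z <ᶠ w)) else 0)) V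
      ≡⟨ cong (increasing (suc (suc k)) P ℕ.+_) (ℕ∑.∑-*ˡ (suc k) _ V) ⟩
    increasing (suc (suc k)) P ℕ.+ suc k ℕ.* increasing (suc (suc k)) P ∎
    where
    open ≡-Reasoning
    V : List (Fin n)
    V = allFin n
    A B : Fin n → Fin n → ℕ
    A y z = if P y then (if P z ∧ (R y z ∧ y <ᶠ z)
                         then increasing k (λ w → (P w ∧ (R y w ∧ y <ᶠ w)) ∧ (R z w ∧ z <ᶠ w)) else 0) else 0
    B y z = if P z then (if P y ∧ (R z y ∧ z <ᶠ y)
                         then increasing k (λ w → (P w ∧ (R z w ∧ z <ᶠ w)) ∧ R y w) else 0) else 0

  ordered≡k!*increasing : ∀ k (P : Fin n → Bool) → ordered k P ≡ (k !) ℕ.* increasing k P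
  ordered≡k!*increasing zero    P = refl
  ordered≡k!*increasing (suc k) P = begin
    ordered (suc k) P
      ≡⟨ ℕ∑.∑-cong (allFin n) (λ z → trans (cong (λ m → if P z then m else 0)
                                              (ordered≡k!*increasing k (λ w → P w ∧ R z w)))
                                        (if-* (P z) (k !) _)) ⟩
    ℕ∑.∑ (λ z → (k !) ℕ.* (if P z then increasing k (λ w → P w ∧ R z w) else 0)) (allFin n)
      ≡⟨ ℕ∑.∑-*ˡ (k !) _ (allFin n) ⟩
    (k !) ℕ.* marked k P                        ≡⟨ cong ((k !) ℕ.*_) (marked≡ k P) ⟩
    (k !) ℕ.* (suc k ℕ.* increasing (suc k) P)  ≡⟨ ℕ.*-assoc (k !) (suc k) _ ⟨
    (k !) ℕ.* suc k ℕ.* increasing (suc k) P    ≡⟨ cong (ℕ._* increasing (suc k) P) (ℕ.*-comm (k !) (suc k)) ⟩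
    suc k ℕ.* (k !) ℕ.* increasing (suc k) P    ∎
    where open ≡-Reasoning

  count-ordered : ∀ k (P : Fin n → Bool) → count (λ v → allV P v ∧ pairwise R v) (tuples k) ≡ ordered k P
  count-ordered zero    P = refl
  count-ordered (suc k) P = trans (count-tuples-suc {n} k _) (ℕ∑.∑-cong (allFin n) first)
    where
    first : ∀ y → count (λ v → (P y ∧ allV P v) ∧ (allV (R y) v ∧ pairwise R v)) (tuples k)
                  ≡ (if P y then ordered k (λ w → P w ∧ R y w) else 0)
    first y with P y
    ... | true  = trans (count-cong (tuples k) λ v → trans (sym (Bool.∧-assoc (allV P v) _ _))
                                                          (cong (_∧ pairwise R v) (sym (allV-∧ P (R y) v))))
                        (count-ordered k (λ w → P w ∧ R y w))
    ... | false = count-false (tuples k)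

  count-increasing : ∀ k (P : Fin n → Bool) →
                     count (λ v → allV P v ∧ (pairwise R v ∧ pairwise _<ᶠ_ v)) (tuples k) ≡ increasing k P
  count-increasing zero    P = refl
  count-increasing (suc k) P = trans (count-tuples-suc {n} k _) (ℕ∑.∑-cong (allFin n) first)
    where
    regroup : ∀ a b c d e → a ∧ ((b ∧ d) ∧ (c ∧ e)) ≡ (a ∧ (b ∧ c)) ∧ (d ∧ e)
    regroup true true  true  d e = refl
    regroup true true  false d e = Bool.∧-zeroʳ _
    regroup true false c     d e = refl
    regroup false b    c     d e = refl
    first : ∀ y → count (λ v → (P y ∧ allV P v) ∧ ((allV (R y) v ∧ pairwise R v) ∧ (allV (y <ᶠ_) v ∧ pairwise _<ᶠ_ v)))
                        (tuples k)
                  ≡ (if P y then increasing k (λ w → P w ∧ (R y w ∧ y <ᶠ w)) else 0)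
    first y with P y
    ... | true  = trans (count-cong (tuples k) λ v →
                          trans (regroup (allV P v) (allV (R y) v) (allV (y <ᶠ_) v) (pairwise R v) (pairwise _<ᶠ_ v))
                                (cong (_∧ (pairwise R v ∧ pairwise _<ᶠ_ v))
                                      (trans (cong (allV P v ∧_) (sym (allV-∧ (R y) (y <ᶠ_) v)))
                                             (sym (allV-∧ P (λ w → R y w ∧ y <ᶠ w) v)))))
                        (count-increasing k (λ w → P w ∧ (R y w ∧ y <ᶠ w)))
    ... | false = count-false (tuples k)

  count-through : ∀ k (P : Fin n → Bool) (Q : Vec (Fin n) k → Bool) x →
                  count (λ v → (allV P v ∧ Q v) ∧ x ∈ᵛ v) (tuples k)
                  ℕ.+ count (λ v → allV (λ z → P z ∧ not (does (z ≟ x))) v ∧ Q v) (tuples k)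
                  ≡ count (λ v → allV P v ∧ Q v) (tuples k)
  count-through k P Q x =
    trans (cong (count (λ v → (allV P v ∧ Q v) ∧ x ∈ᵛ v) (tuples k) ℕ.+_) (count-cong (tuples k) avoids-x))
          (count-split (λ v → allV P v ∧ Q v) (x ∈ᵛ_) (tuples k))
    where
    swap-last : ∀ a b c → (a ∧ c) ∧ b ≡ (a ∧ b) ∧ c
    swap-last true  b c = Bool.∧-comm c b
    swap-last false b c = refl
    avoids-x : ∀ v → allV (λ z → P z ∧ not (does (z ≟ x))) v ∧ Q v ≡ (allV P v ∧ Q v) ∧ not (x ∈ᵛ v)
    avoids-x v = trans (cong (_∧ Q v) (trans (allV-∧ P _ v) (cong (allV P v ∧_) (sym (not-∈ᵛ x v)))))
                       (swap-last (allV P v) (Q v) (not (x ∈ᵛ v)))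

  -- each k-clique through x has k! orderings; subtract the count of cliques avoiding x
  count-ordered-∋ : ∀ k (P : Fin n → Bool) x →
                    count (λ v → (allV P v ∧ pairwise R v) ∧ x ∈ᵛ v) (tuples k)
                    ≡ (k !) ℕ.* count (λ v → (allV P v ∧ (pairwise R v ∧ pairwise _<ᶠ_ v)) ∧ x ∈ᵛ v) (tuples k)
  count-ordered-∋ k P x = ℕ.+-cancelʳ-≡ _ _ _ (begin
    ordered-∋ ℕ.+ ordered k P∖x                         ≡⟨ cong (ordered-∋ ℕ.+_) (sym (count-ordered k P∖x)) ⟩
    ordered-∋ ℕ.+ count (λ v → allV P∖x v ∧ pairwise R v) (tuples k)
                                                        ≡⟨ count-through k P (pairwise R) x ⟩
    count (λ v → allV P v ∧ pairwise R v) (tuples k)    ≡⟨ count-ordered k P ⟩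
    ordered k P                                          ≡⟨ ordered≡k!*increasing k P ⟩
    (k !) ℕ.* increasing k P                             ≡⟨ cong ((k !) ℕ.*_) (sym (count-increasing k P)) ⟩
    (k !) ℕ.* count (λ v → allV P v ∧ (pairwise R v ∧ pairwise _<ᶠ_ v)) (tuples k)
      ≡⟨ cong ((k !) ℕ.*_) (sym (count-through k P (λ v → pairwise R v ∧ pairwise _<ᶠ_ v) x)) ⟩
    (k !) ℕ.* (increasing-∋ ℕ.+ count (λ v → allV P∖x v ∧ (pairwise R v ∧ pairwise _<ᶠ_ v)) (tuples k))
      ≡⟨ cong (λ m → (k !) ℕ.* (increasing-∋ ℕ.+ m)) (count-increasing k P∖x) ⟩
    (k !) ℕ.* (increasing-∋ ℕ.+ increasing k P∖x)        ≡⟨ ℕ.*-distribˡ-+ (k !) increasing-∋ _ ⟩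
    (k !) ℕ.* increasing-∋ ℕ.+ (k !) ℕ.* increasing k P∖x ≡⟨ cong ((k !) ℕ.* increasing-∋ ℕ.+_) (sym (ordered≡k!*increasing k P∖x)) ⟩
    (k !) ℕ.* increasing-∋ ℕ.+ ordered k P∖x             ∎)
    where
    open ≡-Reasoning
    P∖x : Fin n → Bool
    P∖x z = P z ∧ not (does (z ≟ x))
    ordered-∋ increasing-∋ : ℕ
    ordered-∋ = count (λ v → (allV P v ∧ pairwise R v) ∧ x ∈ᵛ v) (tuples k)
    increasing-∋ = count (λ v → (allV P v ∧ (pairwise R v ∧ pairwise _<ᶠ_ v)) ∧ x ∈ᵛ v) (tuples k)

pairwise-cong : ∀ {A : Set} {k} {R R′ : A → A → Bool} → (∀ a b → R a b ≡ R′ a b) →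
                (v : Vec A k) → pairwise R v ≡ pairwise R′ v
pairwise-cong {R = R} {R′} R≡R′ []      = refl
pairwise-cong {R = R} {R′} R≡R′ (y ∷ v) = cong₂ _∧_ (allV-R v) (pairwise-cong R≡R′ v)
  where
  allV-R : ∀ {k} (v : Vec _ k) → allV (R y) v ≡ allV (R′ y) v
  allV-R []      = refl
  allV-R (z ∷ v) = cong₂ _∧_ (R≡R′ y z) (allV-R v)

discrepancyConstant : ℕ → ℚ
discrepancyConstant k = (1ℚ + 1ℚ) * (extrapolationConstant N k * (N * (1ℚ + 1ℚ)) + 1ℚ)
  where open EquallySpaced k using (N)

-- Clique counts through a vertex

sumOver≡∑ : ∀ {n} (U : Subset n) (f : Fin n → ℚ) → sumOver U f ≡ ∑ (λ u → if u ∈ᵇ U then f u else 0ℚ) (allFin n)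
sumOver≡∑ {n} U f = go (allFin n)
  where
  go : ∀ xs → foldr (λ u acc → (if u ∈ᵇ U then f u else 0ℚ) + acc) 0ℚ xs
              ≡ ∑ (λ u → if u ∈ᵇ U then f u else 0ℚ) xs
  go []       = refl
  go (x ∷ xs) = cong ((if x ∈ᵇ U then f x else 0ℚ) +_) (go xs)

-- r = suc k, and q stands for p^(r choose 2)
module CliqueCounts {n : ℕ} (G : Graph n) (k : ℕ) (q : ℚ) (U : Subset n) where

  rTuples : List (Vec (Fin n) (suc k))
  rTuples = tuples (suc k)

  ψ : Vec (Fin n) (suc k) → ℚ
  ψ v = 𝟙 (isLabeledClique G v) - q

  deviation : Subset n → ℚ
  deviation S = ℕ→ℚ (labeledCliques G (suc k) S) - q * ℕ→ℚ (∣ S ∣ˢ ℕ.^ suc k)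

  deviation≡∑ : ∀ S → deviation S ≡ ∑ (λ v → ψ v * 𝟙 (inside G S v)) rTuples
  deviation≡∑ S = begin
    ℕ→ℚ (labeledCliques G (suc k) S) - q * ℕ→ℚ (∣ S ∣ˢ ℕ.^ suc k)
      ≡⟨ cong (λ m → ℕ→ℚ (labeledCliques G (suc k) S) - q * ℕ→ℚ m) ∣S∣^[1+k]≡count ⟩
    ℕ→ℚ (labeledCliques G (suc k) S) - q * ℕ→ℚ (count (inside G S) rTuples)
      ≡⟨ cong₂ (λ a b → a - q * b) (ℕ→ℚ-count _ rTuples) (ℕ→ℚ-count _ rTuples) ⟩
    ∑ (λ v → 𝟙 (inside G S v ∧ isLabeledClique G v)) rTuples - q * ∑ (λ v → 𝟙 (inside G S v)) rTuples
      ≡⟨ cong (λ b → ∑ (λ v → 𝟙 (inside G S v ∧ isLabeledClique G v)) rTuples - b) (∑-*ˡ q _ rTuples) ⟨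
    ∑ (λ v → 𝟙 (inside G S v ∧ isLabeledClique G v)) rTuples - ∑ (λ v → q * 𝟙 (inside G S v)) rTuples
      ≡⟨ ∑-- _ _ rTuples ⟨
    ∑ (λ v → 𝟙 (inside G S v ∧ isLabeledClique G v) - q * 𝟙 (inside G S v)) rTuples
      ≡⟨ ∑-cong rTuples (λ v → trans (cong (_- q * 𝟙 (inside G S v)) (𝟙-∧ (inside G S v) (isLabeledClique G v)))
                                               (factor (𝟙 (inside G S v)) (𝟙 (isLabeledClique G v)) q)) ⟩
    ∑ (λ v → ψ v * 𝟙 (inside G S v)) rTuples ∎
    where
    open ≡-Reasoning
    ∣S∣^[1+k]≡count : ∣ S ∣ˢ ℕ.^ suc k ≡ count (inside G S) rTuples
    ∣S∣^[1+k]≡count = trans (cong (ℕ._^ suc k) (sym (count-∈ᵇ S))) (sym (count-allV (suc k) (_∈ᵇ S)))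
    factor : ∀ a b q → a * b - q * a ≡ (b - q) * a
    factor = solve-∀ ℚ-ring

  labeledThrough tuplesThrough : Fin n → ℕ
  labeledThrough x = count (λ v → (inside G U v ∧ isLabeledClique G v) ∧ x ∈ᵛ v) rTuples
  tuplesThrough  x = count (λ v → inside G U v ∧ x ∈ᵛ v) rTuples

  labeledThrough≡ : ∀ x → labeledThrough x ≡ (suc k !) ℕ.* cU G (suc k) U x
  labeledThrough≡ x = begin
    labeledThrough x
      ≡⟨ count-cong rTuples (λ v → cong (λ b → (inside G U v ∧ b) ∧ x ∈ᵛ v) (pairwise-cong distinct-adj v)) ⟩
    count (λ v → (inside G U v ∧ pairwise (adj G) v) ∧ x ∈ᵛ v) rTuples
      ≡⟨ count-ordered-∋ (suc k) (_∈ᵇ U) x ⟩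
    (suc k !) ℕ.* count (λ v → (inside G U v ∧ (pairwise (adj G) v ∧ pairwise _<ᶠ_ v)) ∧ x ∈ᵛ v) rTuples
      ≡⟨ cong ((suc k !) ℕ.*_) (count-cong rTuples λ v →
           reorder (inside G U v) (pairwise (adj G) v) (pairwise _<ᶠ_ v) (x ∈ᵛ v)) ⟩
    (suc k !) ℕ.* cU G (suc k) U x ∎
    where
    open ≡-Reasoning
    open Sorting (adj G) (Graph.sym G) (irrefl G) using (_<ᶠ_; count-ordered-∋)
    distinct-adj : ∀ a b → not (does (a ≟ b)) ∧ adj G a b ≡ adj G a b
    distinct-adj a b with a ≟ b
    ... | yes refl = sym (irrefl G a)
    ... | no _     = refl
    reorder : ∀ a b c d → (a ∧ (b ∧ c)) ∧ d ≡ c ∧ (b ∧ (a ∧ d))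
    reorder true  true  true  d = refl
    reorder true  true  false d = refl
    reorder true  false c     d = sym (Bool.∧-zeroʳ c)
    reorder false b     c     d = sym (trans (cong (c ∧_) (Bool.∧-zeroʳ b)) (Bool.∧-zeroʳ c))

  coefficient : Vec (Fin n) (suc k) → ℚ
  coefficient v = ψ v * 𝟙 (inside G U v)

  ∑coefficient-through : ∀ x → ∑ (λ v → coefficient v * 𝟙 (x ∈ᵛ v)) rTuples ≡ ℕ→ℚ (labeledThrough x) - q * ℕ→ℚ (tuplesThrough x)
  ∑coefficient-through x = begin
    ∑ (λ v → coefficient v * 𝟙 (x ∈ᵛ v)) rTuples
      ≡⟨ ∑-cong rTuples (λ v → trans (expand (𝟙 (inside G U v)) (𝟙 (isLabeledClique G v)) (𝟙 (x ∈ᵛ v)) q)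
           (sym (cong₂ (λ a b → a - q * b)
             (trans (𝟙-∧ (inside G U v ∧ isLabeledClique G v) (x ∈ᵛ v)) (cong (_* 𝟙 (x ∈ᵛ v)) (𝟙-∧ (inside G U v) (isLabeledClique G v))))
             (𝟙-∧ (inside G U v) (x ∈ᵛ v))))) ⟩
    ∑ (λ v → 𝟙 ((inside G U v ∧ isLabeledClique G v) ∧ x ∈ᵛ v) - q * 𝟙 (inside G U v ∧ x ∈ᵛ v)) rTuples
      ≡⟨ ∑-- _ _ rTuples ⟩
    ∑ (λ v → 𝟙 ((inside G U v ∧ isLabeledClique G v) ∧ x ∈ᵛ v)) rTuples
      - ∑ (λ v → q * 𝟙 (inside G U v ∧ x ∈ᵛ v)) rTuples
      ≡⟨ cong₂ _-_ (sym (ℕ→ℚ-count _ rTuples)) (trans (∑-*ˡ q _ rTuples) (cong (q *_) (sym (ℕ→ℚ-count _ rTuples)))) ⟩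
    ℕ→ℚ (labeledThrough x) - q * ℕ→ℚ (tuplesThrough x) ∎
    where
    open ≡-Reasoning
    expand : ∀ a b c q → ((b - q) * a) * c ≡ (a * b) * c - q * (a * c)
    expand = solve-∀ ℚ-ring

  -- for x ∈ U, tuplesThrough x = |U|^(k+1) - (|U| - 1)^(k+1) = (k+1)|U|^k - defect
  defect : ℕ
  defect = suc k ℕ.* ∣ U ∣ˢ ℕ.^ k ℕ.∸ powerGap (∣ U ∣ˢ ℕ.∸ 1) k

  tuplesThrough+defect : ∀ x → x ∈ᵇ U ≡ true → tuplesThrough x ℕ.+ defect ≡ suc k ℕ.* ∣ U ∣ˢ ℕ.^ k
  tuplesThrough+defect x x∈U = begin
    tuplesThrough x ℕ.+ defect                        ≡⟨ cong (ℕ._+ defect) tuplesThrough≡powerGap ⟩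
    powerGap (∣ U ∣ˢ ℕ.∸ 1) k ℕ.+ defect               ≡⟨ ℕ.m+[n∸m]≡n gap≤ ⟩
    suc k ℕ.* ∣ U ∣ˢ ℕ.^ k                            ∎
    where
    open ≡-Reasoning
    a : ℕ
    a = count (λ z → z ∈ᵇ U ∧ not (does (z ≟ x))) (allFin n)
    ∣U∣≡1+a : ∣ U ∣ˢ ≡ suc a
    ∣U∣≡1+a = trans (sym (count-∈ᵇ U)) (sym (count-remove (_∈ᵇ U) x x∈U))
    gap≤ : powerGap (∣ U ∣ˢ ℕ.∸ 1) k ℕ.≤ suc k ℕ.* ∣ U ∣ˢ ℕ.^ k
    gap≤ rewrite ∣U∣≡1+a = powerGap≤[1+k][1+a]^k a k
    tuplesThrough≡powerGap : tuplesThrough x ≡ powerGap (∣ U ∣ˢ ℕ.∸ 1) k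
    tuplesThrough≡powerGap = begin
      tuplesThrough x                                 ≡⟨ ℕ.m+n∸n≡m (tuplesThrough x) (a ℕ.^ suc k) ⟨
      tuplesThrough x ℕ.+ a ℕ.^ suc k ℕ.∸ a ℕ.^ suc k
        ≡⟨ cong (ℕ._∸ a ℕ.^ suc k) (trans (count-allV-∈ᵛ (suc k) (_∈ᵇ U) x) (cong (ℕ._^ suc k) (count-∈ᵇ U))) ⟩
      ∣ U ∣ˢ ℕ.^ suc k ℕ.∸ a ℕ.^ suc k                 ≡⟨ cong (λ m → m ℕ.^ suc k ℕ.∸ a ℕ.^ suc k) ∣U∣≡1+a ⟩
      powerGap a k                                     ≡⟨ cong (λ m → powerGap (m ℕ.∸ 1) k) ∣U∣≡1+a ⟨
      powerGap (∣ U ∣ˢ ℕ.∸ 1) k                        ∎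

  ∣U∣*defect≤ : ∣ U ∣ˢ ℕ.* defect ℕ.≤ k ℕ.* k ℕ.* ∣ U ∣ˢ ℕ.^ k
  ∣U∣*defect≤ with ∣ U ∣ˢ
  ... | zero  = z≤n
  ... | suc a = [1+a][[1+k][1+a]^k∸powerGap]≤k²[1+a]^k a k

  module _ (W : Fin n → Bool) (W⊆U : ∀ x → W x ≡ true → x ∈ᵇ U ≡ true) where
    open RandomSubset W (_∈ᵇ U)

    -- P_W(t) = E[deviation S] for the random S ⊆ U keeping each vertex of W with probability t
    polynomial : Poly
    polynomial = map (λ v → (coefficient v , coinCount (allFin n) v)) rTuples

    polynomial-degree : DegreeAtMost (suc k) polynomial
    polynomial-degree = All.map⁺ (All.tabulate λ {v} _ → coinCount-bound W v)

    eval-polynomial : ∀ t → eval polynomial t ≡ expect t (allFin n) ⊥ deviation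
    eval-polynomial t = sym (begin
      expect t (allFin n) ⊥ deviation
        ≡⟨ expect-cong t (allFin n) ⊥ deviation≡∑ ⟩
      expect t (allFin n) ⊥ (λ S → ∑ (λ v → ψ v * indicator v S) rTuples)
        ≡⟨ expect-linear t (allFin n) ⊥ ψ indicator rTuples ⟩
      ∑ (λ v → ψ v * expect t (allFin n) ⊥ (indicator v)) rTuples
        ≡⟨ ∑-cong rTuples (λ v → cong (ψ v *_) (trans
             (expect-indicator t (allFin n) ⊥ v (allFin⁺ n) (disjoint (λ y _ → ∈ᵇ-⊥ y)))
             (cong (λ b → 𝟙 b * _) (allV-cong v reachable-everything)))) ⟩
      ∑ (λ v → ψ v * (𝟙 (inside G U v) * t ^ℚ coinCount (allFin n) v)) rTuples
        ≡⟨ ∑-cong rTuples (λ v → sym (*-assoc (ψ v) _ _)) ⟩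
      ∑ (λ v → ψ v * 𝟙 (inside G U v) * t ^ℚ coinCount (allFin n) v) rTuples
        ≡⟨ eval-map _ _ rTuples t ⟨
      eval polynomial t ∎)
      where
      open ≡-Reasoning
      reachable-everything : ∀ y → reachable ⊥ (allFin n) y ≡ y ∈ᵇ U
      reachable-everything y rewrite ∈ᵇ-⊥ y | elem-allFin y with W y in Wy
      ... | true  = sym (W⊆U y Wy)
      ... | false = refl

    derivAt1-polynomial : derivAt1 polynomial
      ≡ ∑ (λ x → 𝟙 (W x) * (ℕ→ℚ (labeledThrough x) - q * ℕ→ℚ (tuplesThrough x))) (allFin n)
    derivAt1-polynomial = begin
      derivAt1 polynomial
        ≡⟨ derivAt1-map coefficient (coinCount (allFin n)) rTuples ⟩
      ∑ (λ v → coefficient v * ℕ→ℚ (coinCount (allFin n) v)) rTuples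
        ≡⟨ ∑-cong rTuples (λ v → trans (cong (coefficient v *_) (ℕ→ℚ-count _ (allFin n))) (sym (∑-*ˡ (coefficient v) _ (allFin n)))) ⟩
      ∑ (λ v → ∑ (λ x → coefficient v * 𝟙 (W x ∧ x ∈ᵛ v)) (allFin n)) rTuples
        ≡⟨ ∑-swap (λ v x → coefficient v * 𝟙 (W x ∧ x ∈ᵛ v)) rTuples (allFin n) ⟩
      ∑ (λ x → ∑ (λ v → coefficient v * 𝟙 (W x ∧ x ∈ᵛ v)) rTuples) (allFin n)
        ≡⟨ ∑-cong (allFin n) (λ x → trans (∑-cong rTuples (λ v → pull-out x v)) (∑-*ˡ (𝟙 (W x)) _ rTuples)) ⟩
      ∑ (λ x → 𝟙 (W x) * ∑ (λ v → coefficient v * 𝟙 (x ∈ᵛ v)) rTuples) (allFin n)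
        ≡⟨ ∑-cong (allFin n) (λ x → cong (𝟙 (W x) *_) (∑coefficient-through x)) ⟩
      ∑ (λ x → 𝟙 (W x) * (ℕ→ℚ (labeledThrough x) - q * ℕ→ℚ (tuplesThrough x))) (allFin n) ∎
      where
      open ≡-Reasoning
      pull-out : ∀ x v → coefficient v * 𝟙 (W x ∧ x ∈ᵛ v) ≡ 𝟙 (W x) * (coefficient v * 𝟙 (x ∈ᵛ v))
      pull-out x v = trans (cong (coefficient v *_) (𝟙-∧ (W x) (x ∈ᵛ v))) (x*[y*z]≡y*[x*z] (coefficient v) (𝟙 (W x)) (𝟙 (x ∈ᵛ v)))
        where
        x*[y*z]≡y*[x*z] : ∀ x y z → x * (y * z) ≡ y * (x * z)
        x*[y*z]≡y*[x*z] = solve-∀ ℚ-ring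

    weightedDeviation weightedDefect : ℚ
    weightedDeviation = ∑ (λ x → 𝟙 (W x) * (ℕ→ℚ (labeledThrough x) - q * ℕ→ℚ (suc k ℕ.* ∣ U ∣ˢ ℕ.^ k))) (allFin n)
    weightedDefect    = ∑ (λ x → 𝟙 (W x) * (q * ℕ→ℚ defect)) (allFin n)

    weightedDeviation≡ : weightedDeviation ≡ derivAt1 polynomial - weightedDefect
    weightedDeviation≡ =
      trans (∑-cong (allFin n) (λ x → split x (W x) refl))
            (trans (∑-- _ _ (allFin n)) (cong (_- weightedDefect) (sym derivAt1-polynomial)))
      where
      split : ∀ x b → W x ≡ b →
              𝟙 b * (ℕ→ℚ (labeledThrough x) - q * ℕ→ℚ (suc k ℕ.* ∣ U ∣ˢ ℕ.^ k))
              ≡ 𝟙 b * (ℕ→ℚ (labeledThrough x) - q * ℕ→ℚ (tuplesThrough x)) - 𝟙 b * (q * ℕ→ℚ defect)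
      split x true  Wx = begin
        1ℚ * (ℕ→ℚ (labeledThrough x) - q * ℕ→ℚ (suc k ℕ.* ∣ U ∣ˢ ℕ.^ k))
          ≡⟨ cong (λ m → 1ℚ * (ℕ→ℚ (labeledThrough x) - q * ℕ→ℚ m)) (tuplesThrough+defect x (W⊆U x Wx)) ⟨
        1ℚ * (ℕ→ℚ (labeledThrough x) - q * ℕ→ℚ (tuplesThrough x ℕ.+ defect))
          ≡⟨ cong (λ m → 1ℚ * (ℕ→ℚ (labeledThrough x) - q * m)) (ℕ→ℚ-+ (tuplesThrough x) defect) ⟩
        1ℚ * (ℕ→ℚ (labeledThrough x) - q * (ℕ→ℚ (tuplesThrough x) + ℕ→ℚ defect))
          ≡⟨ distribute (ℕ→ℚ (labeledThrough x)) q (ℕ→ℚ (tuplesThrough x)) (ℕ→ℚ defect) ⟩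
        1ℚ * (ℕ→ℚ (labeledThrough x) - q * ℕ→ℚ (tuplesThrough x)) - 1ℚ * (q * ℕ→ℚ defect) ∎
        where
        open ≡-Reasoning
        distribute : ∀ ℓ q m d → 1ℚ * (ℓ - q * (m + d)) ≡ 1ℚ * (ℓ - q * m) - 1ℚ * (q * d)
        distribute = solve-∀ ℚ-ring
      split x false _ = vanish (ℕ→ℚ (labeledThrough x) - q * ℕ→ℚ (suc k ℕ.* ∣ U ∣ˢ ℕ.^ k))
                               (ℕ→ℚ (labeledThrough x) - q * ℕ→ℚ (tuplesThrough x)) (q * ℕ→ℚ defect)
        where
        vanish : ∀ a b c → 0ℚ * a ≡ 0ℚ * b - 0ℚ * c
        vanish = solve-∀ ℚ-ring

    0≤weightedDefect : 0ℚ ≤ q → 0ℚ ≤ weightedDefect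
    0≤weightedDefect 0≤q = 0≤∑ (allFin n) (λ x → 0≤* (0≤𝟙 (W x)) (0≤* 0≤q (0≤ℕ→ℚ defect)))

    weightedDefect≤ : 0ℚ ≤ q → q ≤ 1ℚ → weightedDefect ≤ ℕ→ℚ (k ℕ.* k ℕ.* ∣ U ∣ˢ ℕ.^ k)
    weightedDefect≤ 0≤q q≤1 = begin
      weightedDefect                              ≤⟨ ∑-mono-≤ (allFin n) (λ x → only-U x (W x) refl) ⟩
      ∑ (λ x → 𝟙 (x ∈ᵇ U) * ℕ→ℚ defect) (allFin n) ≡⟨ ∑-*ʳ (ℕ→ℚ defect) _ (allFin n) ⟩
      ∑ (λ x → 𝟙 (x ∈ᵇ U)) (allFin n) * ℕ→ℚ defect ≡⟨ cong (_* ℕ→ℚ defect) (ℕ→ℚ-count (_∈ᵇ U) (allFin n)) ⟨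
      ℕ→ℚ (count (_∈ᵇ U) (allFin n)) * ℕ→ℚ defect  ≡⟨ cong (λ m → ℕ→ℚ m * ℕ→ℚ defect) (count-∈ᵇ U) ⟩
      ℕ→ℚ ∣ U ∣ˢ * ℕ→ℚ defect                      ≡⟨ ℕ→ℚ-* ∣ U ∣ˢ defect ⟨
      ℕ→ℚ (∣ U ∣ˢ ℕ.* defect)                      ≤⟨ ℕ→ℚ-mono-≤ ∣U∣*defect≤ ⟩
      ℕ→ℚ (k ℕ.* k ℕ.* ∣ U ∣ˢ ℕ.^ k)                ∎
      where
      open ≤-Reasoning
      only-U : ∀ x b → W x ≡ b → 𝟙 b * (q * ℕ→ℚ defect) ≤ 𝟙 (x ∈ᵇ U) * ℕ→ℚ defect
      only-U x true  Wx rewrite W⊆U x Wx =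
        *-monoˡ-≤-0≤ 1ℚ (0≤𝟙 true) (subst (q * ℕ→ℚ defect ≤_) (*-identityˡ (ℕ→ℚ defect)) (*-monoʳ-≤-0≤ (ℕ→ℚ defect) (0≤ℕ→ℚ defect) q≤1))
      only-U x false _ = subst (_≤ 𝟙 (x ∈ᵇ U) * ℕ→ℚ defect) (sym (*-zeroˡ (q * ℕ→ℚ defect))) (0≤* (0≤𝟙 (x ∈ᵇ U)) (0≤ℕ→ℚ defect))

    open EquallySpaced k using (N; point; 0≤point; point≤1; derivAt1-bound)

    ∣weightedDeviation∣≤ : 0ℚ ≤ q → q ≤ 1ℚ → ∀ {E} → 0ℚ ≤ E → (∀ S → ∣ deviation S ∣ ≤ E) →
                           ∣ weightedDeviation ∣ ≤ extrapolationConstant N k * (N * (E + E)) + ℕ→ℚ (k ℕ.* k ℕ.* ∣ U ∣ˢ ℕ.^ k)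
    ∣weightedDeviation∣≤ 0≤q q≤1 {E} 0≤E ∣deviation∣≤E = begin
      ∣ weightedDeviation ∣                            ≡⟨ cong ∣_∣ weightedDeviation≡ ⟩
      ∣ derivAt1 polynomial - weightedDefect ∣          ≤⟨ ∣p-q∣≤∣p∣+∣q∣ (derivAt1 polynomial) weightedDefect ⟩
      ∣ derivAt1 polynomial ∣ + ∣ weightedDefect ∣      ≡⟨ cong (∣ derivAt1 polynomial ∣ +_) (0≤p⇒∣p∣≡p (0≤weightedDefect 0≤q)) ⟩
      ∣ derivAt1 polynomial ∣ + weightedDefect
        ≤⟨ +-mono-≤ (derivAt1-bound polynomial 0≤E polynomial-degree ∣P∣≤E) (weightedDefect≤ 0≤q q≤1) ⟩
      extrapolationConstant N k * (N * (E + E)) + ℕ→ℚ (k ℕ.* k ℕ.* ∣ U ∣ˢ ℕ.^ k) ∎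
      where
      open ≤-Reasoning
      ∣P∣≤E : ∀ j → j ℕ.≤ suc k → ∣ eval polynomial (point j) ∣ ≤ E
      ∣P∣≤E j j≤ = subst (λ e → ∣ e ∣ ≤ E) (sym (eval-polynomial (point j)))
                         (expect-bound (point j) (0≤point j) (point≤1 j≤) (allFin n) ⊥ ∣deviation∣≤E)

  expected : ℚ
  expected = q * ℕ→ℚ (∣ U ∣ˢ ℕ.^ k) * invFact k

  cliquesThrough : Fin n → ℚ
  cliquesThrough u = ℕ→ℚ (cU G (suc k) U u)

  above below : Fin n → Bool
  above x = x ∈ᵇ U ∧ does (expected ≤? cliquesThrough x)
  below x = x ∈ᵇ U ∧ not (does (expected ≤? cliquesThrough x))

  above⊆U : ∀ x → above x ≡ true → x ∈ᵇ U ≡ true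
  above⊆U x = Bool.∧-conicalˡ (x ∈ᵇ U) _

  below⊆U : ∀ x → below x ≡ true → x ∈ᵇ U ≡ true
  below⊆U x = Bool.∧-conicalˡ (x ∈ᵇ U) _

  labeled-deviation : ∀ x → ℕ→ℚ (labeledThrough x) - q * ℕ→ℚ (suc k ℕ.* ∣ U ∣ˢ ℕ.^ k)
                            ≡ ℕ→ℚ (suc k !) * (cliquesThrough x - expected)
  labeled-deviation x = begin
    ℕ→ℚ (labeledThrough x) - q * ℕ→ℚ (suc k ℕ.* ∣ U ∣ˢ ℕ.^ k)
      ≡⟨ cong₂ (λ a b → a - q * b)
               (trans (cong ℕ→ℚ (labeledThrough≡ x))
                      (trans (ℕ→ℚ-* (suc k !) (cU G (suc k) U x)) (cong (_* c) (ℕ→ℚ-* (suc k) (k !)))))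
               (ℕ→ℚ-* (suc k) (∣ U ∣ˢ ℕ.^ k)) ⟩
    (r * k! * c) - q * (r * u)
      ≡⟨ cong (λ z → (r * k! * c) - z) (*-identityʳ (q * (r * u))) ⟨
    (r * k! * c) - q * (r * u) * 1ℚ
      ≡⟨ cong (λ z → (r * k! * c) - q * (r * u) * z) (ℕ→ℚ-*-inverse (k !) {{k ℕ.!≢0}}) ⟨
    (r * k! * c) - q * (r * u) * (k! * invFact k)
      ≡⟨ factor r k! c q u (invFact k) ⟩
    (r * k!) * (c - expected)
      ≡⟨ cong (_* (c - expected)) (ℕ→ℚ-* (suc k) (k !)) ⟨
    ℕ→ℚ (suc k !) * (c - expected) ∎
    where
    open ≡-Reasoning
    r k! c u : ℚ
    r  = ℕ→ℚ (suc k)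
    k! = ℕ→ℚ (k !)
    c  = cliquesThrough x
    u  = ℕ→ℚ (∣ U ∣ˢ ℕ.^ k)
    factor : ∀ r f c q u i → (r * f * c) - q * (r * u) * (f * i) ≡ (r * f) * (c - q * u * i)
    factor = solve-∀ ℚ-ring

  R!*∑∣cliquesThrough-expected∣ : ℕ→ℚ (suc k !) * sumOver U (λ u → ∣ cliquesThrough u - expected ∣)
    ≡ weightedDeviation above above⊆U - weightedDeviation below below⊆U
  R!*∑∣cliquesThrough-expected∣ = begin
    R! * sumOver U (λ u → ∣ cliquesThrough u - expected ∣)
      ≡⟨ cong (R! *_) (sumOver≡∑ U _) ⟩
    R! * ∑ (λ u → if u ∈ᵇ U then ∣ cliquesThrough u - expected ∣ else 0ℚ) (allFin n)
      ≡⟨ ∑-*ˡ R! _ (allFin n) ⟨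
    ∑ (λ u → R! * (if u ∈ᵇ U then ∣ cliquesThrough u - expected ∣ else 0ℚ)) (allFin n)
      ≡⟨ ∑-cong (allFin n) by-sign ⟩
    ∑ (λ x → 𝟙 (above x) * y x - 𝟙 (below x) * y x) (allFin n)
      ≡⟨ ∑-- _ _ (allFin n) ⟩
    ∑ (λ x → 𝟙 (above x) * y x) (allFin n) - ∑ (λ x → 𝟙 (below x) * y x) (allFin n) ∎
    where
    open ≡-Reasoning
    R! : ℚ
    R! = ℕ→ℚ (suc k !)
    y : Fin n → ℚ
    y x = ℕ→ℚ (labeledThrough x) - q * ℕ→ℚ (suc k ℕ.* ∣ U ∣ˢ ℕ.^ k)
    by-sign : ∀ x → R! * (if x ∈ᵇ U then ∣ cliquesThrough x - expected ∣ else 0ℚ) ≡ 𝟙 (above x) * y x - 𝟙 (below x) * y x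
    by-sign x = trans (split (x ∈ᵇ U)) (cong (λ z → 𝟙 (above x) * z - 𝟙 (below x) * z) (sym (labeled-deviation x)))
      where
      c-e : ℚ
      c-e = cliquesThrough x - expected
      e≤?c : Dec (expected ≤ cliquesThrough x)
      e≤?c = expected ≤? cliquesThrough x
      split : ∀ b → R! * (if b then ∣ c-e ∣ else 0ℚ)
                    ≡ 𝟙 (b ∧ does e≤?c) * (R! * c-e) - 𝟙 (b ∧ not (does e≤?c)) * (R! * c-e)
      split true  = trans (cong (R! *_) (∣q-p∣≡±[q-p] expected (cliquesThrough x) e≤?c))
                          (distribute R! (𝟙 (does e≤?c)) (𝟙 (not (does e≤?c))) c-e)
        where
        distribute : ∀ r a b d → r * (a * d - b * d) ≡ a * (r * d) - b * (r * d)
        distribute = solve-∀ ℚ-ring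
      split false = vanish R! (R! * c-e)
        where
        vanish : ∀ r d → r * 0ℚ ≡ 0ℚ * d - 0ℚ * d
        vanish = solve-∀ ℚ-ring

  open EquallySpaced k using (N)

  ∑∣cliquesThrough-expected∣≤ : 0ℚ ≤ q → q ≤ 1ℚ → ∀ {E} → 0ℚ ≤ E → (∀ S → ∣ deviation S ∣ ≤ E) →
                                ℕ→ℚ (k ℕ.* k ℕ.* ∣ U ∣ˢ ℕ.^ k) ≤ E →
                                sumOver U (λ u → ∣ cliquesThrough u - expected ∣) ≤ discrepancyConstant k * E
  ∑∣cliquesThrough-expected∣≤ 0≤q q≤1 {E} 0≤E ∣deviation∣≤E k²∣U∣^k≤E = begin
    total                           ≡⟨ *-identityˡ total ⟨
    1ℚ * total                      ≤⟨ *-monoʳ-≤-0≤ total 0≤total (ℕ→ℚ-mono-≤ (ℕ.1≤n! (suc k))) ⟩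
    ℕ→ℚ (suc k !) * total             ≡⟨ R!*∑∣cliquesThrough-expected∣ ⟩
    T₊ - T₋                         ≤⟨ ≤-trans (p≤∣p∣ (T₊ - T₋)) (∣p-q∣≤∣p∣+∣q∣ T₊ T₋) ⟩
    ∣ T₊ ∣ + ∣ T₋ ∣                  ≤⟨ +-mono-≤ (bound above above⊆U) (bound below below⊆U) ⟩
    (B + E) + (B + E)               ≡⟨ collect (extrapolationConstant N k) N E ⟩
    discrepancyConstant k * E       ∎
    where
    open ≤-Reasoning
    total T₊ T₋ B : ℚ
    total = sumOver U (λ u → ∣ cliquesThrough u - expected ∣)
    T₊ = weightedDeviation above above⊆U
    T₋ = weightedDeviation below below⊆U
    B  = extrapolationConstant N k * (N * (E + E))
    0≤total : 0ℚ ≤ total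
    0≤total = subst (0ℚ ≤_) (sym (sumOver≡∑ U _)) (0≤∑ (allFin n) λ u → 0≤if (u ∈ᵇ U) (0≤∣p∣ _))
      where
      0≤if : ∀ b {x} → 0ℚ ≤ x → 0ℚ ≤ (if b then x else 0ℚ)
      0≤if true  0≤x = 0≤x
      0≤if false _   = ≤-refl
    bound : ∀ W W⊆U → ∣ weightedDeviation W W⊆U ∣ ≤ B + E
    bound W W⊆U = ≤-trans (∣weightedDeviation∣≤ W W⊆U 0≤q q≤1 0≤E ∣deviation∣≤E) (+-monoʳ-≤ B k²∣U∣^k≤E)
    collect : ∀ K N E → (K * (N * (E + E)) + E) + (K * (N * (E + E)) + E) ≡ (1ℚ + 1ℚ) * (K * (N * (1ℚ + 1ℚ)) + 1ℚ) * E
    collect = solve-∀ ℚ-ring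

0≤p^ℚj≤1 : ∀ {p} → 0ℚ ≤ p → p ≤ 1ℚ → ∀ j → 0ℚ ≤ p ^ℚ j × p ^ℚ j ≤ 1ℚ
0≤p^ℚj≤1 0≤p p≤1 zero    = ℚ.*≤* (ℤ.+≤+ z≤n) , ≤-refl
0≤p^ℚj≤1 {p} 0≤p p≤1 (suc j) with 0≤p^ℚj≤1 0≤p p≤1 j
... | 0≤p^j , p^j≤1 = 0≤* 0≤p 0≤p^j , subst (p * p ^ℚ j ≤_) (*-identityˡ 1ℚ) (*-mono-≤-0≤ 0≤p p≤1 0≤p^j p^j≤1)

k²∣U∣^k≤δn^[1+k] : ∀ {n} k δ (U : Subset n) → 0ℚ < δ → k ℕ.* k ℕ.* ↧ₙ δ ℕ.≤ n →
                   ℕ→ℚ (k ℕ.* k ℕ.* ∣ U ∣ˢ ℕ.^ k) ≤ δ * ℕ→ℚ (n ℕ.^ suc k)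
k²∣U∣^k≤δn^[1+k] {n} k δ U 0<δ n₀≤n = begin
  ℕ→ℚ (k ℕ.* k ℕ.* ∣ U ∣ˢ ℕ.^ k)  ≤⟨ ℕ→ℚ-mono-≤ (ℕ.*-monoʳ-≤ (k ℕ.* k) (ℕ.^-monoˡ-≤ k (∣p∣≤n U))) ⟩
  ℕ→ℚ (k ℕ.* k ℕ.* n ℕ.^ k)       ≡⟨ ℕ→ℚ-* (k ℕ.* k) (n ℕ.^ k) ⟩
  ℕ→ℚ (k ℕ.* k) * ℕ→ℚ (n ℕ.^ k)   ≤⟨ *-monoʳ-≤-0≤ (ℕ→ℚ (n ℕ.^ k)) (0≤ℕ→ℚ (n ℕ.^ k)) (ℕ→ℚ[m]≤p*ℕ→ℚ[n] δ (k ℕ.* k) n 0<δ n₀≤n) ⟩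
  δ * ℕ→ℚ n * ℕ→ℚ (n ℕ.^ k)       ≡⟨ *-assoc δ (ℕ→ℚ n) (ℕ→ℚ (n ℕ.^ k)) ⟩
  δ * (ℕ→ℚ n * ℕ→ℚ (n ℕ.^ k))     ≡⟨ cong (δ *_) (ℕ→ℚ-* n (n ℕ.^ k)) ⟨
  δ * ℕ→ℚ (n ℕ.^ suc k)           ∎
  where open ≤-Reasoning

-- r ≥ 2 only serves to exclude r = 0
corollary2p2 : (r : ℕ) → r ≥ 2 →
    Σ ℚ λ C → (p δ : ℚ) → 0ℚ < p → p < 1ℚ → 0ℚ < δ →
      Σ ℕ λ n₀ → (n : ℕ) → n ≥ n₀ → (G : Graph n) → PStar G r p δ →
        (U : Subset n) → sumOver U (disc G r p U) ≤ C * δ * ℕ→ℚ (n ℕ.^ r)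
corollary2p2 zero    ()
corollary2p2 (suc k) _ = discrepancyConstant k , λ p δ 0<p p<1 0<δ → k ℕ.* k ℕ.* ↧ₙ δ , λ n n₀≤n G P* U →
  let 0≤q , q≤1 = 0≤p^ℚj≤1 (<⇒≤ 0<p) (<⇒≤ p<1) (suc k C 2)
      0≤E       = 0≤* (<⇒≤ 0<δ) (0≤ℕ→ℚ (n ℕ.^ suc k))
  in ≤-trans (CliqueCounts.∑∣cliquesThrough-expected∣≤ G k (p ^ℚ (suc k C 2)) U 0≤q q≤1 0≤E P*
                (k²∣U∣^k≤δn^[1+k] k δ U 0<δ n₀≤n))
             (≤-reflexive (sym (*-assoc (discrepancyConstant k) δ (ℕ→ℚ (n ℕ.^ suc k)))))
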